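{- Let $k \geq 3$ and $t \geq 1$. If $\Gamma$ is a $k$-regular graph of girth $2t+1$ containing no cycle of length $2t+2$ and having order $M(k,2t+1) + (k-2)k(k-1)^{t-1}$, then $4t+2$ divides \[ \bigl(M(k,2t+1) + (k-2)k(k-1)^{t-1}\bigr)\, k(k-1)^{t-1}. \]
   Context: All graphs are finite, simple and undirected; the girth is the length of a shortest cycle. $M(k,2t+1) = \frac{k(k-1)^{t}-2}{k-2}$ is the Moore bound for odd girth $2t+1$. -}

module Defs where

open import Data.Nat using (ℕ; zero; suc; _+_; _*_; _∸_; _^_; _≤_; _<_; s≤s; z≤n; NonZero)
open import Data.Nat.DivMod using (_/_)
open import Data.Fin using (Fin; zero; suc; inject₁; fromℕ)
open import Data.Bool using (Bool; true; false; T; if_then_else_)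
open import Data.List using (List; map)
open import Data.Nat.ListAction using (sum)
open import Data.List.Base using (allFin)
open import Data.Product using (Σ; _×_; ∃)
open import Data.Empty using (⊥)
open import Relation.Nullary using (¬_)
open import Relation.Binary.PropositionalEquality using (_≡_)
open import Function.Definitions using (Injective)

record Graph (n : ℕ) : Set where
  field
    adj   : Fin n → Fin n → Bool
    sym   : ∀ u v → adj u v ≡ adj v u
    irrefl : ∀ v → adj v v ≡ false

open Graph public

Adj : ∀ {n} → Graph n → Fin n → Fin n → Set
Adj G u v = T (adj G u v)

degree : ∀ {n} → Graph n → Fin n → ℕ
degree {n} G v = sum (map (λ u → if adj G v u then 1 else 0) (allFin n))

Regular : ∀ {n} → ℕ → Graph n → Set
Regular k G = ∀ v → degree G v ≡ k

record Cycle {n : ℕ} (G : Graph n) (m : ℕ) : Set where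
  field
    vs    : Fin (suc m) → Fin n
    inj   : Injective _≡_ _≡_ vs
    steps : ∀ (i : Fin m) → Adj G (vs (inject₁ i)) (vs (suc i))
    close : Adj G (vs (fromℕ m)) (vs zero)

HasCycleOfLength : ∀ {n} → Graph n → ℕ → Set
HasCycleOfLength G L = 3 ≤ L × Σ ℕ (λ m → (L ≡ suc m) × Cycle G m)

Girth : ∀ {n} → Graph n → ℕ → Set
Girth G g = HasCycleOfLength G g × (∀ L → L < g → ¬ HasCycleOfLength G L)

≥3⇒NonZero : ∀ {k} → 3 ≤ k → NonZero (k ∸ 2)
≥3⇒NonZero (s≤s (s≤s (s≤s _))) = record { nonZero = _ }

moore : (k t : ℕ) → 3 ≤ k → ℕ
moore k t k≥3 = _/_ (k * (k ∸ 1) ^ t ∸ 2) (k ∸ 2) {{≥3⇒NonZero k≥3}}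

-- Call a list of 2t + 1 distinct vertices whose consecutive entries, cyclically, are adjacent
-- a rooted oriented cycle. Rotation acts freely on these lists, so g = 2t + 1 divides their
-- number. Fix the last vertex v. Non-backtracking walks from v of length at most t have
-- distinct endpoints (there are no cycles shorter than g), and so do those of length t + 1
-- (there are no cycles of length g + 1); counting endpoints against
-- n = M(k,g) + (k-2)k(k-1)^(t-1) leaves exactly k(k-1)^(t-1) walks of length t + 1 that end
-- where a walk of length t ends. Cutting a cycle through v after t + 1 vertices is a
-- bijection onto these walks, because gluing two such walks closes a non-backtracking walk
-- of length g, which must be a cycle. Hence there are n·k(k-1)^(t-1) rooted oriented cycles.
-- This number is even because n·k is, and g is odd, so 2g divides it.

module Submission where

open import Defs hiding (sym)
open import Data.Nat using (ℕ; zero; suc; _+_; _*_; _∸_; _^_; _≤_; _<_; s≤s; z≤n; _/_)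
open import Data.Nat.Properties
  using ( +-suc; +-comm; +-assoc; +-identityʳ; *-identityʳ; *-zeroʳ; *-assoc; *-comm; suc-injective; m+n∸n≡m; m∸n≤m; m∸n+n≡m
        ; ≤-refl; ≤-reflexive; ≤-trans; ≤-antisym; ≤-total; ≤-pred; n≤1+n; m≤m+n; m≤n+m; m<m+n; m≤n⇒m≤1+n; m≤n⇒m<n∨m≡n; 1+n≰n; 1+n≢n
        ; +-mono-≤; +-monoˡ-≤; +-monoʳ-≤; +-cancelˡ-≤; +-cancelʳ-≤; +-cancelˡ-≡; module ≤-Reasoning )
open import Data.Nat.Induction using (<-wellFounded)
open import Data.Nat.Solver using (module +-*-Solver)
open +-*-Solver using (solve; _:+_; _:*_; _:=_; con)
open import Data.Nat.ListAction using (sum)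
open import Data.Nat.DivMod using (m*n/n≡m)
open import Data.Nat.Divisibility using (_∣_; divides; ∣m∣n⇒∣m+n; ∣m⇒∣m*n; *-monoˡ-∣)
open import Data.Nat.Coprimality using (Coprime; coprime-divisor; coprime-+; 1-coprimeTo)
open import Data.Fin using (Fin; zero; suc; inject₁; fromℕ; _≟_)
import Data.Fin as Fin
import Data.Fin.Properties as Fin
open import Data.Bool using (T; true; false; if_then_else_)
open import Data.Empty using (⊥)
open import Data.Maybe using (just; nothing)
import Data.Maybe.Properties as Maybe
open import Data.Maybe.Relation.Binary.Connected using (Connected; just; just-nothing; nothing-just; nothing)
open import Data.Product using (∃; ∃₂; _×_; _,_; proj₁; proj₂)
open import Data.Sum using (_⊎_; inj₁; inj₂)
open import Data.List
  using (List; []; _∷_; _++_; _∷ʳ_; [_]; map; length; head; lookup; concatMap; filter; allFin; upTo; take; reverse; _ʳ++_)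
open import Data.List.Properties
  using ( length-++; length-map; length-upTo; length-tabulate; length-ʳ++; length-reverse; map-cong; map-tabulate
        ; ++-assoc; ++-identityʳ; ++-cancelʳ; ∷-injectiveˡ; ∷-injectiveʳ; ∷ʳ-injective; ++-ʳ++; ʳ++-ʳ++; ʳ++-defn; reverse-injective )
import Data.List.Properties as List
open import Data.List.Membership.Propositional using (_∈_; _∉_; find; lose)
open import Data.List.Membership.Propositional.Properties
  using ( ∈-∃++; ∈-++⁻; ∈-++⁺ˡ; ∈-++⁺ʳ; ∈-map⁻; ∈-map⁺; ∈-filter⁻; ∈-filter⁺; ∈-concatMap⁻; ∈-concatMap⁺
        ; ∈-allFin; ∈-upTo⁺; ∈-upTo⁻; ∈-lookup )
open import Data.List.Membership.DecPropositional using (_∈?_)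
open import Data.List.Relation.Binary.Subset.Propositional using (_⊆_)
open import Data.List.Relation.Binary.Disjoint.Propositional using (Disjoint)
open import Data.List.Relation.Unary.Any using (Any; here; there; any?)
open import Data.List.Relation.Unary.All as All using (All; []; _∷_)
import Data.List.Relation.Unary.All.Properties as All
open import Data.List.Relation.Unary.AllPairs using (AllPairs; []; _∷_)
import Data.List.Relation.Unary.AllPairs.Properties as AllPairs
open import Data.List.Relation.Unary.Linked as Linked using (Linked; []; [-]; _∷_; linked?)
open import Data.List.Relation.Unary.Unique.Propositional using (Unique)
import Data.List.Relation.Unary.Unique.Propositional.Properties as Unique
import Data.List.Relation.Unary.Unique.DecPropositional as UniqueDec
open import Function using (_∘_)
open import Induction.WellFounded using (Acc; acc)
open import Relation.Nullary using (¬_; Dec; yes; no; does; contradiction; ¬?)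
open import Relation.Nullary.Decidable using (_×-dec_; T?; map′)
open import Relation.Unary using (Pred; Decidable)
open import Relation.Unary.Properties using (∁?)
open import Relation.Binary using (Rel; REL; Symmetric; DecidableEquality)
import Relation.Binary as B
open import Relation.Binary.PropositionalEquality
  using (_≡_; _≢_; refl; sym; trans; cong; cong₂; subst; subst₂; module ≡-Reasoning)

-- Counting duplicate-free lists

module _ {A : Set} where

  length-≤-of-⊆ : {xs ys : List A} → Unique xs → xs ⊆ ys → length xs ≤ length ys
  length-≤-of-⊆ {[]} _ _ = z≤n
  length-≤-of-⊆ {x ∷ xs} {ys} (x∉xs ∷ xs!) xs⊆ys
    with as , bs , refl ← ∈-∃++ (xs⊆ys (here refl)) = begin
      suc (length xs)              ≤⟨ s≤s (length-≤-of-⊆ xs! xs⊆as++bs) ⟩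
      suc (length (as ++ bs))      ≡⟨ cong suc (length-++ as) ⟩
      suc (length as + length bs)  ≡⟨ +-suc (length as) (length bs) ⟨
      length as + length (x ∷ bs)  ≡⟨ length-++ as ⟨
      length (as ++ x ∷ bs)        ∎
    where
      open ≤-Reasoning
      xs⊆as++bs : xs ⊆ as ++ bs
      xs⊆as++bs y∈xs with ∈-++⁻ as (xs⊆ys (there y∈xs))
      ... | inj₁ y∈as         = ∈-++⁺ˡ y∈as
      ... | inj₂ (here refl)  = contradiction refl (All.lookup x∉xs y∈xs)
      ... | inj₂ (there y∈bs) = ∈-++⁺ʳ as y∈bs

  Unique-++⁻ : ∀ xs {ys : List A} → Unique (xs ++ ys) → Unique xs × Unique ys × Disjoint xs ys
  Unique-++⁻ []       ys!              = [] , ys! , λ ()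
  Unique-++⁻ (x ∷ xs) (x∉xs++ys ∷ xs++ys!) with xs! , ys! , disjoint ← Unique-++⁻ xs xs++ys! =
      All.tabulate (λ y∈xs → All.lookup x∉xs++ys (∈-++⁺ˡ y∈xs)) ∷ xs! , ys!
    , λ { (here refl , y∈ys)  → All.lookup x∉xs++ys (∈-++⁺ʳ xs y∈ys) refl
        ; (there y∈xs , y∈ys) → disjoint (y∈xs , y∈ys) }

  length-≡-of-⊆-⊇ : {xs ys : List A} → Unique xs → Unique ys → xs ⊆ ys → ys ⊆ xs → length xs ≡ length ys
  length-≡-of-⊆-⊇ xs! ys! xs⊆ys ys⊆xs = ≤-antisym (length-≤-of-⊆ xs! xs⊆ys) (length-≤-of-⊆ ys! ys⊆xs)

  Unique⇒AllPairs : ∀ {ℓ} {R : Rel A ℓ} {xs} → Unique xs → (∀ {x y} → x ∈ xs → y ∈ xs → x ≢ y → R x y)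
                  → AllPairs R xs
  Unique⇒AllPairs {xs = []} [] _ = []
  Unique⇒AllPairs {xs = x ∷ xs} (x∉xs ∷ xs!) R-on-xs =
    All.tabulate (λ y∈xs → R-on-xs (here refl) (there y∈xs) (All.lookup x∉xs y∈xs))
    ∷ Unique⇒AllPairs xs! (λ x∈xs y∈xs → R-on-xs (there x∈xs) (there y∈xs))

  sum-map-+ : (f g : A → ℕ) (xs : List A) → sum (map (λ x → f x + g x) xs) ≡ sum (map f xs) + sum (map g xs)
  sum-map-+ f g [] = refl
  sum-map-+ f g (x ∷ xs) = begin
    (f x + g x) + sum (map (λ x → f x + g x) xs)              ≡⟨ cong (f x + g x +_) (sum-map-+ f g xs) ⟩
    (f x + g x) + (sum (map f xs) + sum (map g xs))           ≡⟨ +-assoc (f x) (g x) _ ⟩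
    f x + (g x + (sum (map f xs) + sum (map g xs)))           ≡⟨ cong (f x +_) (interchange (g x) (sum (map f xs)) _) ⟩
    f x + (sum (map f xs) + (g x + sum (map g xs)))           ≡⟨ +-assoc (f x) _ _ ⟨
    (f x + sum (map f xs)) + (g x + sum (map g xs))           ∎
    where
      open ≡-Reasoning
      interchange : ∀ a b c → a + (b + c) ≡ b + (a + c)
      interchange a b c = trans (sym (+-assoc a b c)) (trans (cong (_+ c) (+-comm a b)) (+-assoc b a c))

  sum-map-const : (f : A → ℕ) {c : ℕ} (xs : List A) → (∀ {x} → x ∈ xs → f x ≡ c) → sum (map f xs) ≡ length xs * c
  sum-map-const f [] _ = refl
  sum-map-const f (x ∷ xs) f≡c = cong₂ _+_ (f≡c (here refl)) (sum-map-const f xs (f≡c ∘ there))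

  module _ {p} {P : Pred A p} (P? : Decidable P) where

    length-filter≡sum : (xs : List A) → length (filter P? xs) ≡ sum (map (λ x → if does (P? x) then 1 else 0) xs)
    length-filter≡sum [] = refl
    length-filter≡sum (x ∷ xs) with does (P? x)
    ... | true  = cong suc (length-filter≡sum xs)
    ... | false = length-filter≡sum xs

    length-filter+length-filter-∁ : (xs : List A) → length (filter P? xs) + length (filter (∁? P?) xs) ≡ length xs
    length-filter+length-filter-∁ [] = refl
    length-filter+length-filter-∁ (x ∷ xs) with does (P? x)
    ... | true  = cong suc (length-filter+length-filter-∁ xs)
    ... | false = trans (+-suc _ _) (cong suc (length-filter+length-filter-∁ xs))

module _ {A B : Set} where

  Unique-map⁺ : (f : A → B) {xs : List A} → (∀ {x y} → x ∈ xs → y ∈ xs → f x ≡ f y → x ≡ y)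
              → Unique xs → Unique (map f xs)
  Unique-map⁺ f f-inj xs! = AllPairs.map⁺ (Unique⇒AllPairs xs! (λ x∈xs y∈xs x≢y → x≢y ∘ f-inj x∈xs y∈xs))

  Unique-concatMap⁺ : (f : A → List B) {xs : List A} → Unique xs → (∀ {x} → x ∈ xs → Unique (f x))
                    → (∀ {x y} → x ∈ xs → y ∈ xs → x ≢ y → Disjoint (f x) (f y)) → Unique (concatMap f xs)
  Unique-concatMap⁺ f xs! f! disjoint =
    Unique.concat⁺ (All.map⁺ (All.tabulate f!)) (AllPairs.map⁺ (Unique⇒AllPairs xs! disjoint))

  length-concatMap : (f : A → List B) (xs : List A) → length (concatMap f xs) ≡ sum (map (length ∘ f) xs)
  length-concatMap f [] = refl
  length-concatMap f (x ∷ xs) = trans (length-++ (f x)) (cong (length (f x) +_) (length-concatMap f xs))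

  length-≡-of-bijection : (f : A → B) {xs : List A} {ys : List B} → Unique xs → Unique ys
                        → (∀ {x x′} → x ∈ xs → x′ ∈ xs → f x ≡ f x′ → x ≡ x′)
                        → (∀ {x} → x ∈ xs → f x ∈ ys) → (∀ {y} → y ∈ ys → ∃ λ x → x ∈ xs × f x ≡ y)
                        → length xs ≡ length ys
  length-≡-of-bijection f {xs} xs! ys! f-inj f-into f-onto =
    trans (sym (length-map f xs)) (length-≡-of-⊆-⊇ (Unique-map⁺ f f-inj xs!) ys! image⊆ys ys⊆image)
    where
      image⊆ys : map f xs ⊆ _
      image⊆ys fx∈ with x , x∈xs , refl ← ∈-map⁻ f fx∈ = f-into x∈xs
      ys⊆image : _ ⊆ map f xs
      ys⊆image y∈ys with x , x∈xs , refl ← f-onto y∈ys = ∈-map⁺ f x∈xs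

  module _ {ℓ} {R : REL A B ℓ} (R? : B.Decidable R) where

    length-≡-sum-of-fibres : (ys : List B) (xs : List A) → (∀ {x} → x ∈ xs → length (filter (R? x) ys) ≡ 1)
                         → length xs ≡ sum (map (λ y → length (filter (λ x → R? x y) xs)) ys)
    length-≡-sum-of-fibres ys [] _ = sym (trans (sum-map-const _ ys (λ _ → refl)) (*-zeroʳ (length ys)))
    length-≡-sum-of-fibres ys (x ∷ xs) one-each = sym (begin
      sum (map (λ y → length (filter (λ x′ → R? x′ y) (x ∷ xs))) ys)
        ≡⟨ cong sum (map-cong length-filter-∷ ys) ⟩
      sum (map (λ y → (if does (R? x y) then 1 else 0) + length (filter (λ x′ → R? x′ y) xs)) ys)
        ≡⟨ sum-map-+ _ _ ys ⟩
      sum (map (λ y → if does (R? x y) then 1 else 0) ys) + sum (map (λ y → length (filter (λ x′ → R? x′ y) xs)) ys)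
        ≡⟨ cong₂ _+_ (trans (sym (length-filter≡sum (R? x) ys)) (one-each (here refl)))
                     (sym (length-≡-sum-of-fibres ys xs (one-each ∘ there))) ⟩
      suc (length xs) ∎)
      where
        open ≡-Reasoning
        length-filter-∷ : ∀ y → length (filter (λ x′ → R? x′ y) (x ∷ xs))
                              ≡ (if does (R? x y) then 1 else 0) + length (filter (λ x′ → R? x′ y) xs)
        length-filter-∷ y with does (R? x y)
        ... | true  = refl
        ... | false = refl

module _ {A : Set} (_≟_ : DecidableEquality A) {p} {P : Pred A p} (P? : Decidable P) where

  filter-≢-∉ : ∀ {y} (xs : List A) → y ∉ xs → filter (λ x → P? x ×-dec ¬? (x ≟ y)) xs ≡ filter P? xs
  filter-≢-∉ [] _ = refl
  filter-≢-∉ {y} (x ∷ xs) y∉x∷xs with x ≟ y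
  ... | yes refl = contradiction (here refl) y∉x∷xs
  ... | no _ with does (P? x)
  ...   | true  = cong (x ∷_) (filter-≢-∉ xs (y∉x∷xs ∘ there))
  ...   | false = filter-≢-∉ xs (y∉x∷xs ∘ there)

  length-filter-≢ : ∀ {y} (xs : List A) → Unique xs → y ∈ xs → P y
                  → suc (length (filter (λ x → P? x ×-dec ¬? (x ≟ y)) xs)) ≡ length (filter P? xs)
  length-filter-≢ (x ∷ xs) (x∉xs ∷ _) (here refl) Px with x ≟ x
  ... | no x≢x = contradiction refl x≢x
  ... | yes _ with P? x
  ...   | no ¬Px = contradiction Px ¬Px
  ...   | yes _  = cong suc (cong length (filter-≢-∉ xs (λ x∈xs → All.lookup x∉xs x∈xs refl)))
  length-filter-≢ {y} (x ∷ xs) (x∉xs ∷ xs!) (there y∈xs) Py with x ≟ y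
  ... | yes refl = contradiction refl (All.lookup x∉xs y∈xs)
  ... | no _ with does (P? x)
  ...   | true  = cong suc (length-filter-≢ xs xs! y∈xs Py)
  ...   | false = length-filter-≢ xs xs! y∈xs Py

module _ {A : Set} {p} {P : Pred A p} (P? : Decidable P) where

  length-filter-unique-witness : ∀ {y} (xs : List A) → Unique xs → y ∈ xs → P y → (∀ {z} → P z → z ≡ y)
                               → length (filter P? xs) ≡ 1
  length-filter-unique-witness (x ∷ xs) (x∉xs ∷ _) (here refl) Py only-y with P? x
  ... | no ¬Px = contradiction Py ¬Px
  ... | yes _  = cong suc (none xs (λ z∈xs Pz → All.lookup x∉xs z∈xs (sym (only-y Pz))))
    where
      none : ∀ xs → (∀ {z} → z ∈ xs → ¬ P z) → length (filter P? xs) ≡ 0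
      none []       _      = refl
      none (z ∷ xs) ¬P-xs with P? z
      ... | yes Pz = contradiction Pz (¬P-xs (here refl))
      ... | no _   = none xs (¬P-xs ∘ there)
  length-filter-unique-witness (x ∷ xs) (x∉xs ∷ xs!) (there y∈xs) Py only-y with P? x
  ... | yes Px = contradiction (only-y Px) (λ x≡y → All.lookup x∉xs y∈xs x≡y)
  ... | no _   = length-filter-unique-witness xs xs! y∈xs Py only-y

distinct-heads⇒length≤ : ∀ {n} {xss : List (List (Fin n))} → AllPairs (λ xs ys → head xs ≢ head ys) xss
                       → (∀ {xs} → xs ∈ xss → xs ≢ []) → length xss ≤ n
distinct-heads⇒length≤ {n} {xss} distinct nonempty = begin
  length xss                    ≡⟨ length-map head xss ⟨
  length (map head xss)         ≤⟨ length-≤-of-⊆ (AllPairs.map⁺ distinct) heads⊆ ⟩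
  length (map just (allFin n))  ≡⟨ trans (length-map just (allFin n)) (length-tabulate {n = n} (λ i → i)) ⟩
  n                             ∎
  where
    open ≤-Reasoning
    heads⊆ : map head xss ⊆ map just (allFin n)
    heads⊆ h∈ with xs , xs∈ , refl ← ∈-map⁻ head {xs = xss} h∈ with xs | nonempty xs∈
    ... | x ∷ _ | _     = ∈-map⁺ just (∈-allFin x)
    ... | []    | []≢[] = contradiction refl []≢[]

-- Walks as lists

module _ {A : Set} where

  infixr 5 _∷ˡ_

  data Last : List A → A → Set where
    [-]  : ∀ {x} → Last [ x ] x
    _∷ˡ_ : ∀ {xs v} y → Last xs v → Last (y ∷ xs) v

  Last-functional : ∀ {xs a b} → Last xs a → Last xs b → a ≡ b
  Last-functional [-]        [-]         = refl
  Last-functional (_ ∷ˡ ())  [-]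
  Last-functional [-]        (_ ∷ˡ ())
  Last-functional (_ ∷ˡ l)   (_ ∷ˡ l′)   = Last-functional l l′

  Last⇒∈ : ∀ {xs v} → Last xs v → v ∈ xs
  Last⇒∈ [-]      = here refl
  Last⇒∈ (_ ∷ˡ l) = there (Last⇒∈ l)

  Last⇒∷ʳ : ∀ {xs v} → Last xs v → ∃ λ ys → xs ≡ ys ∷ʳ v
  Last⇒∷ʳ [-] = [] , refl
  Last⇒∷ʳ (y ∷ˡ l) with ys , refl ← Last⇒∷ʳ l = y ∷ ys , refl

  Last-++⁺ : ∀ xs {ys v} → Last ys v → Last (xs ++ ys) v
  Last-++⁺ []       l = l
  Last-++⁺ (x ∷ xs) l = x ∷ˡ Last-++⁺ xs l

  Last-++⁻ : ∀ xs {y ys v} → Last (xs ++ y ∷ ys) v → Last (y ∷ ys) v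
  Last-++⁻ []           l        = l
  Last-++⁻ (x ∷ [])     (_ ∷ˡ l) = l
  Last-++⁻ (x ∷ x′ ∷ xs) (_ ∷ˡ l) = Last-++⁻ (x′ ∷ xs) l

  Last-ʳ++⁺ : ∀ xs {ys v} → Last ys v → Last (xs ʳ++ ys) v
  Last-ʳ++⁺ []       l = l
  Last-ʳ++⁺ (x ∷ xs) l = Last-ʳ++⁺ xs (x ∷ˡ l)

  data NonBacktracking : List A → Set where
    []    : NonBacktracking []
    [-]   : ∀ {x} → NonBacktracking [ x ]
    [-,-] : ∀ {x y} → NonBacktracking (x ∷ y ∷ [])
    _∷_   : ∀ {x y z xs} → x ≢ z → NonBacktracking (y ∷ z ∷ xs) → NonBacktracking (x ∷ y ∷ z ∷ xs)

  NonBacktracking-tail : ∀ {x xs} → NonBacktracking (x ∷ xs) → NonBacktracking xs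
  NonBacktracking-tail [-]       = []
  NonBacktracking-tail [-,-]     = [-]
  NonBacktracking-tail (_ ∷ nb)  = nb

  NonBacktracking-++⁻ˡ : ∀ xs {ys} → NonBacktracking (xs ++ ys) → NonBacktracking xs
  NonBacktracking-++⁻ˡ []               _         = []
  NonBacktracking-++⁻ˡ (x ∷ [])         _         = [-]
  NonBacktracking-++⁻ˡ (x ∷ y ∷ [])     _         = [-,-]
  NonBacktracking-++⁻ˡ (x ∷ y ∷ z ∷ xs) (x≢z ∷ nb) = x≢z ∷ NonBacktracking-++⁻ˡ (y ∷ z ∷ xs) nb

  NonBacktracking-++⁻ʳ : ∀ xs {ys} → NonBacktracking (xs ++ ys) → NonBacktracking ys
  NonBacktracking-++⁻ʳ []       nb = nb
  NonBacktracking-++⁻ʳ (x ∷ xs) nb = NonBacktracking-++⁻ʳ xs (NonBacktracking-tail nb)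

  Unique⇒NonBacktracking : ∀ {xs} → Unique xs → NonBacktracking xs
  Unique⇒NonBacktracking {[]}              _                    = []
  Unique⇒NonBacktracking {x ∷ []}          _                    = [-]
  Unique⇒NonBacktracking {x ∷ y ∷ []}      _                    = [-,-]
  Unique⇒NonBacktracking {x ∷ y ∷ z ∷ xs} (x∉ ∷ xs!) = All.lookup x∉ (there (here refl)) ∷ Unique⇒NonBacktracking xs!

  -- Gluing two walks that leave x in different directions: the only new
  -- triple is (head xs, x, head ys).
  NonBacktracking-ʳ++ : ∀ {x} xs ys → NonBacktracking (x ∷ xs) → NonBacktracking (x ∷ ys)
                      → Connected _≢_ (head xs) (head ys) → NonBacktracking (xs ʳ++ x ∷ ys)
  NonBacktracking-ʳ++ [] ys _ nb-ys _ = nb-ys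
  NonBacktracking-ʳ++ {x} (y ∷ xs) ys nb-xs nb-ys y≢ys =
    NonBacktracking-ʳ++ xs (x ∷ ys) (NonBacktracking-tail nb-xs) (extend ys nb-ys y≢ys) (turn xs nb-xs)
    where
      extend : ∀ ys → NonBacktracking (x ∷ ys) → Connected _≢_ (just y) (head ys) → NonBacktracking (y ∷ x ∷ ys)
      extend []       _     _          = [-,-]
      extend (z ∷ ys) nb-ys (just y≢z) = y≢z ∷ nb-ys
      turn : ∀ xs → NonBacktracking (x ∷ y ∷ xs) → Connected _≢_ (head xs) (just x)
      turn []       _         = nothing-just
      turn (w ∷ xs) (x≢w ∷ _) = just (x≢w ∘ sym)

  module _ {ℓ} {R : Rel A ℓ} where

    Linked-++⁻ˡ : ∀ xs {ys} → Linked R (xs ++ ys) → Linked R xs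
    Linked-++⁻ˡ []           _         = []
    Linked-++⁻ˡ (x ∷ [])     _         = [-]
    Linked-++⁻ˡ (x ∷ y ∷ xs) (r ∷ rs)  = r ∷ Linked-++⁻ˡ (y ∷ xs) rs

    Linked-++⁻ʳ : ∀ xs {ys} → Linked R (xs ++ ys) → Linked R ys
    Linked-++⁻ʳ []       rs = rs
    Linked-++⁻ʳ (x ∷ xs) rs = Linked-++⁻ʳ xs (Linked.tail rs)

    Linked-ʳ++ : Symmetric R → ∀ {x} xs {ys} → Linked R (x ∷ xs) → Linked R (x ∷ ys) → Linked R (xs ʳ++ x ∷ ys)
    Linked-ʳ++ R-sym []       _          rs = rs
    Linked-ʳ++ R-sym (y ∷ xs) (r ∷ rs′) rs = Linked-ʳ++ R-sym xs rs′ (R-sym r ∷ rs)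

  lookup-injective : ∀ {xs : List A} → Unique xs → ∀ i j → lookup xs i ≡ lookup xs j → i ≡ j
  lookup-injective {x ∷ xs} _           zero    zero    _  = refl
  lookup-injective {x ∷ xs} (x∉ ∷ _)    zero    (suc j) eq = contradiction eq (All.lookup x∉ (∈-lookup j))
  lookup-injective {x ∷ xs} (x∉ ∷ _)    (suc i) zero    eq = contradiction (sym eq) (All.lookup x∉ (∈-lookup i))
  lookup-injective {x ∷ xs} (_ ∷ xs!)  (suc i) (suc j) eq = cong suc (lookup-injective xs! i j eq)

  lookup-fromℕ : ∀ x xs {v} → Last (x ∷ xs) v → lookup (x ∷ xs) (fromℕ (length xs)) ≡ v
  lookup-fromℕ x []       [-]      = refl
  lookup-fromℕ x (y ∷ xs) (_ ∷ˡ l) = lookup-fromℕ y xs l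

  module _ (_≟ᴬ_ : DecidableEquality A) where

    unique-or-duplicate : ∀ (xs : List A) → Unique xs ⊎ ∃₂ λ as y → ∃₂ λ bs cs → xs ≡ as ++ y ∷ bs ++ y ∷ cs
    unique-or-duplicate [] = inj₁ []
    unique-or-duplicate (x ∷ xs) with _∈?_ _≟ᴬ_ x xs
    ... | yes x∈xs with bs , cs , refl ← ∈-∃++ x∈xs = inj₂ ([] , x , bs , cs , refl)
    ... | no x∉xs with unique-or-duplicate xs
    ...   | inj₁ xs! = inj₁ (All.tabulate (λ y∈xs x≡y → x∉xs (subst (_∈ xs) (sym x≡y) y∈xs)) ∷ xs!)
    ...   | inj₂ (as , y , bs , cs , refl) = inj₂ (x ∷ as , y , bs , cs , refl)

  length-∷ʳ-ʳ++ : ∀ (ini : List A) v x ys → length (ini ʳ++ x ∷ ys) ≡ length (ini ∷ʳ v) + length ys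
  length-∷ʳ-ʳ++ ini v x ys = begin
    length (ini ʳ++ x ∷ ys)        ≡⟨ length-ʳ++ ini ⟩
    length ini + suc (length ys)   ≡⟨ +-suc (length ini) (length ys) ⟩
    suc (length ini) + length ys   ≡⟨ cong (_+ length ys) (trans (+-comm 1 (length ini)) (sym (length-++ ini))) ⟩
    length (ini ∷ʳ v) + length ys  ∎
    where open ≡-Reasoning

  last⁺ : A → List A → A
  last⁺ x []       = x
  last⁺ _ (y ∷ ys) = last⁺ y ys

  Last-last⁺ : ∀ x xs → Last (x ∷ xs) (last⁺ x xs)
  Last-last⁺ x []       = [-]
  Last-last⁺ x (y ∷ ys) = x ∷ˡ Last-last⁺ y ys

  last⁺-∷ʳ : ∀ x xs y → last⁺ x (xs ∷ʳ y) ≡ y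
  last⁺-∷ʳ x []       y = refl
  last⁺-∷ʳ x (z ∷ xs) y = last⁺-∷ʳ z xs y

  Linked-∷ʳ : ∀ {ℓ} {R : Rel A ℓ} x xs {y} → Linked R (x ∷ xs) → R (last⁺ x xs) y → Linked R (x ∷ xs ∷ʳ y)
  Linked-∷ʳ x []       _          r = r ∷ [-]
  Linked-∷ʳ x (z ∷ xs) (x~z ∷ rs) r = x~z ∷ Linked-∷ʳ z xs rs r

  lists-of-length : List A → ℕ → List (List A)
  lists-of-length xs zero    = [ [] ]
  lists-of-length xs (suc m) = concatMap (λ x → map (x ∷_) (lists-of-length xs m)) xs

  ∈-lists-of-length⁻ : ∀ {xs} m {c} → c ∈ lists-of-length xs m → length c ≡ m
  ∈-lists-of-length⁻ zero (here refl) = refl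
  ∈-lists-of-length⁻ {xs} (suc m) c∈
    with x , _ , c∈x∷ ← find (∈-concatMap⁻ (λ x → map (x ∷_) (lists-of-length xs m)) {xs = xs} c∈)
    with c′ , c′∈ , refl ← ∈-map⁻ (x ∷_) {xs = lists-of-length xs m} c∈x∷ = cong suc (∈-lists-of-length⁻ m c′∈)

  ∈-lists-of-length⁺ : ∀ {xs} m {c} → All (_∈ xs) c → length c ≡ m → c ∈ lists-of-length xs m
  ∈-lists-of-length⁺ zero    {[]}    _            _   = here refl
  ∈-lists-of-length⁺ {xs} (suc m) {x ∷ c} (x∈xs ∷ c⊆xs) ∣c∣≡ =
    ∈-concatMap⁺ (λ x → map (x ∷_) (lists-of-length xs m))
      (lose x∈xs (∈-map⁺ (x ∷_) (∈-lists-of-length⁺ m c⊆xs (suc-injective ∣c∣≡))))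

  lists-of-length! : ∀ {xs} m → Unique xs → Unique (lists-of-length xs m)
  lists-of-length! zero    _   = [] ∷ []
  lists-of-length! {xs} (suc m) xs! = Unique-concatMap⁺ _ xs! (λ _ → Unique.map⁺ ∷-injectiveʳ (lists-of-length! m xs!))
    λ _ _ x≢y (c∈ , c∈′) →
      let _ , _ , c≡  = ∈-map⁻ _ {xs = lists-of-length xs m} c∈
          _ , _ , c≡′ = ∈-map⁻ _ {xs = lists-of-length xs m} c∈′ in
      x≢y (∷-injectiveˡ (trans (sym c≡) c≡′))

  Last? : DecidableEquality A → ∀ xs v → Dec (Last xs v)
  Last? _≟ᴬ_ []       v = no λ ()
  Last? _≟ᴬ_ (x ∷ xs) v =
    map′ (λ eq → subst (Last (x ∷ xs)) eq (Last-last⁺ x xs)) (Last-functional (Last-last⁺ x xs)) (last⁺ x xs ≟ᴬ v)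

  take-suc-++ : ∀ {t} (as : List A) x bs → length as ≡ t → take (suc t) (as ++ x ∷ bs) ≡ as ∷ʳ x
  take-suc-++ []       x bs refl = refl
  take-suc-++ (a ∷ as) x bs refl = cong (a ∷_) (take-suc-++ as x bs refl)

  ʳ++-injectiveˡ : ∀ (xs ys : List A) {zs} → xs ʳ++ zs ≡ ys ʳ++ zs → xs ≡ ys
  ʳ++-injectiveˡ xs ys {zs} eq =
    reverse-injective (++-cancelʳ zs (reverse xs) (reverse ys) (trans (sym (ʳ++-defn xs)) (trans eq (ʳ++-defn ys))))

  Connected-nothing : ∀ {ℓ} {R : A → A → Set ℓ} m → Connected R m nothing
  Connected-nothing (just _) = just-nothing
  Connected-nothing nothing  = nothing

-- Rotations

module _ {A : Set} where

  rotate : List A → List A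
  rotate []       = []
  rotate (x ∷ xs) = xs ∷ʳ x

  rotate^ : ℕ → List A → List A
  rotate^ zero    xs = xs
  rotate^ (suc d) xs = rotate^ d (rotate xs)

  length-rotate : (xs : List A) → length (rotate xs) ≡ length xs
  length-rotate []       = refl
  length-rotate (x ∷ xs) = trans (length-++ xs) (+-comm (length xs) 1)

  rotate^-+ : ∀ a b (xs : List A) → rotate^ (a + b) xs ≡ rotate^ b (rotate^ a xs)
  rotate^-+ zero    b xs = refl
  rotate^-+ (suc a) b xs = rotate^-+ a b (rotate xs)

  rotate^-++ : (as bs : List A) → rotate^ (length as) (as ++ bs) ≡ bs ++ as
  rotate^-++ []       bs = sym (++-identityʳ bs)
  rotate^-++ (a ∷ as) bs = begin
    rotate^ (length as) ((as ++ bs) ∷ʳ a)  ≡⟨ cong (rotate^ (length as)) (++-assoc as bs [ a ]) ⟩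
    rotate^ (length as) (as ++ bs ∷ʳ a)    ≡⟨ rotate^-++ as (bs ∷ʳ a) ⟩
    (bs ∷ʳ a) ++ as                        ≡⟨ ++-assoc bs [ a ] as ⟩
    bs ++ a ∷ as                           ∎
    where open ≡-Reasoning

  rotate-injective : {xs ys : List A} → rotate xs ≡ rotate ys → xs ≡ ys
  rotate-injective {[]}     {[]}     _ = refl
  rotate-injective {x ∷ xs} {y ∷ ys} eq with refl , refl ← ∷ʳ-injective xs ys eq = refl
  rotate-injective {[]}     {y ∷ []} ()
  rotate-injective {[]}     {y ∷ _ ∷ _} ()
  rotate-injective {x ∷ []} {[]} ()
  rotate-injective {x ∷ _ ∷ _} {[]} ()

  rotate^-injective : ∀ d {xs ys : List A} → rotate^ d xs ≡ rotate^ d ys → xs ≡ ys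
  rotate^-injective zero    eq = eq
  rotate^-injective (suc d) eq = rotate-injective (rotate^-injective d eq)

  split-at : ∀ d (xs : List A) → d < length xs → ∃₂ λ as y → ∃ λ bs → xs ≡ as ++ y ∷ bs × length as ≡ d
  split-at zero    (y ∷ bs) _ = [] , y , bs , refl , refl
  split-at (suc d) (a ∷ xs) (s≤s d<∣xs∣) with as , y , bs , refl , refl ← split-at d xs d<∣xs∣ =
    a ∷ as , y , bs , refl , refl

module _ {N : ℕ} where

  HeadMinimal : List (Fin N) → Set
  HeadMinimal []       = ⊥
  HeadMinimal (x ∷ xs) = All (x Fin.≤_) xs

  headMinimal? : Decidable HeadMinimal
  headMinimal? []       = no λ ()
  headMinimal? (x ∷ xs) = All.all? (x Fin.≤?_) xs

  ∃-minimum : (x : Fin N) (xs : List (Fin N))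
            → ∃₂ λ as μ → ∃ λ bs → x ∷ xs ≡ as ++ μ ∷ bs × All (μ Fin.≤_) (x ∷ xs)
  ∃-minimum x [] = [] , x , [] , refl , Fin.≤-refl ∷ []
  ∃-minimum x (y ∷ ys) with as , μ , bs , eq , μ≤ ← ∃-minimum y ys | Fin.≤-total x μ
  ... | inj₁ x≤μ = [] , x , y ∷ ys , refl , Fin.≤-refl ∷ All.map (Fin.≤-trans x≤μ) μ≤
  ... | inj₂ μ≤x = x ∷ as , μ , bs , cong (x ∷_) eq , μ≤x ∷ μ≤

  rotate-to-headMinimal : (x : Fin N) (xs : List (Fin N))
                        → ∃₂ λ as μ → ∃ λ bs → x ∷ xs ≡ as ++ μ ∷ bs × HeadMinimal (μ ∷ bs ++ as)
  rotate-to-headMinimal x xs with as , μ , bs , eq , μ≤ ← ∃-minimum x xs =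
    as , μ , bs , eq , All.tabulate (All.lookup μ≤ ∘ subst (_ ∈_) (sym eq) ∘ swap)
    where
      swap : ∀ {y} → y ∈ bs ++ as → y ∈ as ++ μ ∷ bs
      swap y∈ with ∈-++⁻ bs y∈
      ... | inj₁ y∈bs = ∈-++⁺ʳ as (there y∈bs)
      ... | inj₂ y∈as = ∈-++⁺ˡ y∈as

  headMinimal-rotate^ : ∀ {c} d → HeadMinimal c → Unique c → 0 < d → d < length c → ¬ HeadMinimal (rotate^ d c)
  headMinimal-rotate^ {x ∷ xs} (suc d) x≤xs (x∉xs ∷ _) _ (s≤s d<∣xs∣) y-min
    with as , y , bs , refl , refl ← split-at d xs d<∣xs∣ = All.lookup x∉xs y∈xs (Fin.≤-antisym x≤y y≤x)
    where
      y∈xs = ∈-++⁺ʳ as (here refl)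
      x≤y = All.lookup x≤xs y∈xs
      y≤x = All.lookup (subst HeadMinimal (rotate^-++ (x ∷ as) (y ∷ bs)) y-min) (∈-++⁺ʳ bs (here refl))

  module _ (m : ℕ) where

    private
      rotate^-shift : ∀ {c c′ : List (Fin N)} {i j} → i ≤ j → rotate^ (suc i) c ≡ rotate^ (suc j) c′
                    → c ≡ rotate^ (j ∸ i) c′
      rotate^-shift {c} {c′} {i} {j} i≤j eq = rotate^-injective (suc i) (begin
        rotate^ (suc i) c                     ≡⟨ eq ⟩
        rotate^ (suc j) c′                    ≡⟨ cong (λ a → rotate^ a c′) j+1≡ ⟩
        rotate^ (j ∸ i + suc i) c′            ≡⟨ rotate^-+ (j ∸ i) (suc i) c′ ⟩
        rotate^ (suc i) (rotate^ (j ∸ i) c′)  ∎)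
        where
          open ≡-Reasoning
          j+1≡ : suc j ≡ j ∸ i + suc i
          j+1≡ = trans (cong suc (sym (m∸n+n≡m i≤j))) (sym (+-suc (j ∸ i) i))

      rotations-injective-≤ : ∀ {c c′ i j} → HeadMinimal c → HeadMinimal c′ → Unique c′ → length c′ ≡ suc m
                            → i ≤ j → j ≤ m → rotate^ (suc i) c ≡ rotate^ (suc j) c′ → i ≡ j × c ≡ c′
      rotations-injective-≤ {c} {c′} {i} {j} c-min c′-min c′! ∣c′∣≡ i≤j j≤m eq =
        by-distance (j ∸ i) refl (rotate^-shift i≤j eq)
        where
          by-distance : ∀ d → j ∸ i ≡ d → c ≡ rotate^ d c′ → i ≡ j × c ≡ c′
          by-distance zero    j∸i≡0 c≡c′ = trans (sym (cong (_+ i) j∸i≡0)) (m∸n+n≡m i≤j) , c≡c′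
          by-distance (suc d) j∸i≡d c≡   =
            contradiction (subst HeadMinimal c≡ c-min) (headMinimal-rotate^ (suc d) c′-min c′! (s≤s z≤n) d<∣c′∣)
            where
              d<∣c′∣ : suc d < length c′
              d<∣c′∣ = subst (suc d <_) (sym ∣c′∣≡) (s≤s (≤-trans (subst (_≤ j) j∸i≡d (m∸n≤m j i)) j≤m))

    rotations-injective : ∀ {c c′ i j} → HeadMinimal c → HeadMinimal c′ → Unique c → Unique c′
                        → length c ≡ suc m → length c′ ≡ suc m → i ≤ m → j ≤ m
                        → rotate^ (suc i) c ≡ rotate^ (suc j) c′ → i ≡ j × c ≡ c′
    rotations-injective {i = i} {j} c-min c′-min c! c′! ∣c∣≡ ∣c′∣≡ i≤m j≤m eq with ≤-total i j
    ... | inj₁ i≤j = rotations-injective-≤ c-min c′-min c′! ∣c′∣≡ i≤j j≤m eq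
    ... | inj₂ j≤i with j≡i , c′≡c ← rotations-injective-≤ c′-min c-min c! ∣c∣≡ j≤i i≤m (sym eq) =
      sym j≡i , sym c′≡c

    orbit : List (Fin N) → List (List (Fin N))
    orbit c = map (λ i → rotate^ (suc i) c) (upTo (suc m))

    length-orbit : ∀ c → length (orbit c) ≡ suc m
    length-orbit c = trans (length-map _ (upTo (suc m))) (length-upTo (suc m))

    ∈-orbit-of-headMinimal : ∀ {c} → length c ≡ suc m → ∃₂ λ d a → rotate^ a c ≡ d × HeadMinimal d × c ∈ orbit d
    ∈-orbit-of-headMinimal {x ∷ xs} ∣c∣≡ with as , μ , bs , eq , μ-min ← rotate-to-headMinimal x xs =
      μ ∷ bs ++ as , length as , trans (cong (rotate^ (length as)) eq) (rotate^-++ as (μ ∷ bs)) , μ-min ,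
      subst (_∈ orbit (μ ∷ bs ++ as)) (trans (rotate^-++ (μ ∷ bs) as) (sym eq)) (∈-map⁺ _ (∈-upTo⁺ ∣bs∣<))
      where
        ∣bs∣< : length bs < suc m
        ∣bs∣< = subst (suc (length bs) ≤_) (trans (sym (length-++ as)) (trans (cong length (sym eq)) ∣c∣≡))
                  (m≤n+m (suc (length bs)) (length as))

    Unique-orbits : ∀ {reps} → Unique reps → (∀ {c} → c ∈ reps → HeadMinimal c × Unique c × length c ≡ suc m)
                  → Unique (concatMap orbit reps)
    Unique-orbits reps! rep = Unique-concatMap⁺ orbit reps!
        (λ c∈ → Unique-map⁺ _ (λ i∈ j∈ → proj₁ ∘ same-rotation c∈ c∈ i∈ j∈) (Unique.upTo⁺ (suc m)))
        (λ c∈ c′∈ c≢c′ (v∈ , v∈′) →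
          let i , i∈ , v≡ = ∈-map⁻ _ v∈ ; j , j∈ , v≡′ = ∈-map⁻ _ v∈′ in
          c≢c′ (proj₂ (same-rotation c∈ c′∈ i∈ j∈ (trans (sym v≡) v≡′))))
      where
        same-rotation : ∀ {c c′ i j} → c ∈ _ → c′ ∈ _ → i ∈ upTo (suc m) → j ∈ upTo (suc m)
                      → rotate^ (suc i) c ≡ rotate^ (suc j) c′ → i ≡ j × c ≡ c′
        same-rotation c∈ c′∈ i∈ j∈ =
          let c-min , c! , ∣c∣≡ = rep c∈ ; c′-min , c′! , ∣c′∣≡ = rep c′∈ in
          rotations-injective c-min c′-min c! c′! ∣c∣≡ ∣c′∣≡ (≤-pred (∈-upTo⁻ i∈)) (≤-pred (∈-upTo⁻ j∈))

    -- The head-minimal lists in cs represent the rotation orbits, each of size m + 1.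
    rotation-closed⇒∣length : {cs : List (List (Fin N))} → Unique cs → (∀ {c} → c ∈ cs → Unique c)
                            → (∀ {c} → c ∈ cs → length c ≡ suc m) → (∀ {c} → c ∈ cs → rotate c ∈ cs)
                            → suc m ∣ length cs
    rotation-closed⇒∣length {cs} cs! c! ∣c∣≡ rotate-closed = divides (length reps) (begin
      length cs                        ≡⟨ length-≡-of-⊆-⊇ cs! orbits! cs⊆orbits orbits⊆cs ⟩
      length (concatMap orbit reps)    ≡⟨ length-concatMap orbit reps ⟩
      sum (map (length ∘ orbit) reps)  ≡⟨ sum-map-const _ reps (λ {c} _ → length-orbit c) ⟩
      length reps * suc m              ∎)
      where
        open ≡-Reasoning
        reps = filter headMinimal? cs

        rotate^-closed : ∀ a {c} → c ∈ cs → rotate^ a c ∈ cs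
        rotate^-closed zero    c∈cs = c∈cs
        rotate^-closed (suc a) c∈cs = rotate^-closed a (rotate-closed c∈cs)

        orbits! : Unique (concatMap orbit reps)
        orbits! = Unique-orbits (Unique.filter⁺ headMinimal? cs!) λ c∈ →
          let c∈cs , c-min = ∈-filter⁻ headMinimal? c∈ in c-min , c! c∈cs , ∣c∣≡ c∈cs

        orbits⊆cs : concatMap orbit reps ⊆ cs
        orbits⊆cs c′∈ with find (∈-concatMap⁻ orbit c′∈)
        ... | c , c∈reps , c′∈orbit with ∈-map⁻ (λ i → rotate^ (suc i) c) {xs = upTo (suc m)} c′∈orbit
        ... | i , _ , refl = rotate^-closed (suc i) (proj₁ (∈-filter⁻ headMinimal? c∈reps))

        cs⊆orbits : cs ⊆ concatMap orbit reps
        cs⊆orbits c∈cs with d , a , refl , d-min , c∈orbit ← ∈-orbit-of-headMinimal (∣c∣≡ c∈cs) =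
          ∈-concatMap⁺ orbit (lose (∈-filter⁺ headMinimal? (rotate^-closed a c∈cs) d-min) c∈orbit)

-- Arithmetic and degree sums

walk-count : ℕ → ℕ → ℕ
walk-count k zero    = 1
walk-count k (suc j) = k * (k ∸ 1) ^ j

walk-count-suc : ∀ {k j} → 2 ≤ k → 1 ≤ j → walk-count k (suc j) ≡ walk-count k j + (k ∸ 2) * walk-count k j
walk-count-suc {suc (suc s)} {suc j} (s≤s (s≤s _)) _ = distrib s ((suc s) ^ j)
  where
    distrib : ∀ s x → (2 + s) * ((1 + s) * x) ≡ (2 + s) * x + s * ((2 + s) * x)
    distrib = solve 2 (λ s x → (con 2 :+ s) :* ((con 1 :+ s) :* x) := (con 2 :+ s) :* x :+ s :* ((con 2 :+ s) :* x)) refl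

ball-count : ℕ → ℕ → ℕ
ball-count k zero    = 1
ball-count k (suc j) = ball-count k j + walk-count k (suc j)

ball-count-closed-form : ∀ s t → s * ball-count (2 + s) t + 2 ≡ (2 + s) * (1 + s) ^ t
ball-count-closed-form s zero    = solve 1 (λ s → s :* con 1 :+ con 2 := (con 2 :+ s) :* con 1) refl s
ball-count-closed-form s (suc t) = begin
  s * (B + (2 + s) * X) + 2          ≡⟨ regroup s B X ⟩
  (s * B + 2) + s * ((2 + s) * X)    ≡⟨ cong (_+ s * ((2 + s) * X)) (ball-count-closed-form s t) ⟩
  (2 + s) * X + s * ((2 + s) * X)    ≡⟨ expand s X ⟩
  (2 + s) * ((1 + s) * X)            ∎
  where
    open ≡-Reasoning
    B = ball-count (2 + s) t
    X = (1 + s) ^ t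
    regroup : ∀ s b x → s * (b + (2 + s) * x) + 2 ≡ (s * b + 2) + s * ((2 + s) * x)
    regroup = solve 3 (λ s b x → s :* (b :+ (con 2 :+ s) :* x) :+ con 2 := (s :* b :+ con 2) :+ s :* ((con 2 :+ s) :* x)) refl
    expand : ∀ s x → (2 + s) * x + s * ((2 + s) * x) ≡ (2 + s) * ((1 + s) * x)
    expand = solve 2 (λ s x → (con 2 :+ s) :* x :+ s :* ((con 2 :+ s) :* x) := (con 2 :+ s) :* ((con 1 :+ s) :* x)) refl

moore≡ball-count : ∀ k t (k≥3 : 3 ≤ k) → moore k t k≥3 ≡ ball-count k t
moore≡ball-count (suc (suc (suc s))) t (s≤s (s≤s (s≤s _))) = begin
  (k * (k ∸ 1) ^ t ∸ 2) / suc s              ≡⟨ cong (λ m → (m ∸ 2) / suc s) (ball-count-closed-form (suc s) t) ⟨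
  (suc s * B + 2 ∸ 2) / suc s                ≡⟨ cong (_/ suc s) (trans (m+n∸n≡m (suc s * B) 2) (*-comm (suc s) B)) ⟩
  B * suc s / suc s                          ≡⟨ m*n/n≡m B (suc s) ⟩
  B                                          ∎
  where
    open ≡-Reasoning
    k = suc (suc (suc s))
    B = ball-count k t

2t+1≡suc[t+t] : ∀ t → 2 * t + 1 ≡ suc (t + t)
2t+1≡suc[t+t] t = trans (+-comm (2 * t) 1) (cong (λ m → suc (t + m)) (+-identityʳ t))

2t+1-coprime-2 : ∀ t → Coprime (2 * t + 1) 2
2t+1-coprime-2 zero    = 1-coprimeTo 2
2t+1-coprime-2 (suc t) = subst (λ m → Coprime m 2) (2+[2t+1]≡ t) (coprime-+ (2t+1-coprime-2 t))
  where
    2+[2t+1]≡ : ∀ t → 2 + (2 * t + 1) ≡ 2 * suc t + 1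
    2+[2t+1]≡ = solve 1 (λ t → con 2 :+ (con 2 :* t :+ con 1) := con 2 :* (con 1 :+ t) :+ con 1) refl

coprime-∣⇒*∣ : ∀ {a b m} → Coprime a b → a ∣ m → b ∣ m → a * b ∣ m
coprime-∣⇒*∣ {a} {b} a⊥b a∣m (divides q refl) = *-monoˡ-∣ b (coprime-divisor a⊥b (subst (a ∣_) (*-comm q b) a∣m))

∑ : ∀ m → (Fin m → ℕ) → ℕ
∑ m f = sum (map f (allFin m))

∑-suc : ∀ m (f : Fin (suc m) → ℕ) → ∑ (suc m) f ≡ f zero + ∑ m (f ∘ suc)
∑-suc m f = cong (λ xs → f zero + sum xs) (trans (map-tabulate suc f) (sym (map-tabulate (λ i → i) (f ∘ suc))))

∑-cong : ∀ m {f g : Fin m → ℕ} → (∀ i → f i ≡ g i) → ∑ m f ≡ ∑ m g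
∑-cong m f≗g = cong sum (map-cong f≗g (allFin m))

handshake : ∀ m (f : Fin m → Fin m → ℕ) → (∀ i j → f i j ≡ f j i) → (∀ i → f i i ≡ 0)
          → 2 ∣ ∑ m (λ i → ∑ m (f i))
handshake zero    f _      _    = divides 0 refl
handshake (suc m) f f-sym f-diag = subst (2 ∣_) (sym split) (∣m∣n⇒∣m+n (divides R (twice R)) inner)
  where
    R = ∑ m (f zero ∘ suc)
    S = ∑ m (λ i → ∑ m (f (suc i) ∘ suc))
    inner : 2 ∣ S
    inner = handshake m (λ i j → f (suc i) (suc j)) (λ i j → f-sym (suc i) (suc j)) (f-diag ∘ suc)
    twice : ∀ r → r + r ≡ r * 2
    twice r = trans (cong (r +_) (sym (+-identityʳ r))) (*-comm 2 r)
    split : ∑ (suc m) (λ i → ∑ (suc m) (f i)) ≡ (R + R) + S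
    split = begin
      ∑ (suc m) (λ i → ∑ (suc m) (f i))
        ≡⟨ ∑-suc m _ ⟩
      ∑ (suc m) (f zero) + ∑ m (λ i → ∑ (suc m) (f (suc i)))
        ≡⟨ cong₂ _+_ (trans (∑-suc m (f zero)) (cong (_+ R) (f-diag zero))) (∑-cong m (λ i → ∑-suc m (f (suc i)))) ⟩
      R + ∑ m (λ i → f (suc i) zero + ∑ m (f (suc i) ∘ suc))
        ≡⟨ cong (R +_) (sum-map-+ (λ i → f (suc i) zero) (λ i → ∑ m (f (suc i) ∘ suc)) (allFin m)) ⟩
      R + (∑ m (λ i → f (suc i) zero) + S)
        ≡⟨ cong (λ r → R + (r + S)) (∑-cong m (λ i → f-sym (suc i) zero)) ⟩
      R + (R + S)
        ≡⟨ +-assoc R R S ⟨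
      (R + R) + S ∎
      where open ≡-Reasoning

regular⇒2∣n*k : ∀ {n k} (Γ : Graph n) → Regular k Γ → 2 ∣ n * k
regular⇒2∣n*k {n} {k} Γ regular = subst (2 ∣_) degree-sum (handshake n (λ i j → if adj Γ i j then 1 else 0)
  (λ i j → cong (λ b → if b then 1 else 0) (Graph.sym Γ i j)) (λ i → cong (λ b → if b then 1 else 0) (irrefl Γ i)))
  where
    degree-sum : ∑ n (degree Γ) ≡ n * k
    degree-sum = trans (sum-map-const (degree Γ) (allFin n) (λ {v} _ → regular v))
                       (cong (_* k) (length-tabulate {n = n} (λ i → i)))

-- Closed walks and cycles

module _ {n : ℕ} (Γ : Graph n) where

  Adj-sym : Symmetric (Adj Γ)
  Adj-sym {u} {v} = subst T (Graph.sym Γ u v)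

  Adj-irrefl : ∀ {u} → ¬ Adj Γ u u
  Adj-irrefl {u} = subst T (irrefl Γ u)

  cycle-of-walk : ∀ x xs {u} → Unique (x ∷ xs) → Linked (Adj Γ) (x ∷ xs) → Last (x ∷ xs) u → Adj Γ u x
                → 3 ≤ suc (length xs) → HasCycleOfLength Γ (suc (length xs))
  cycle-of-walk x xs x∷xs! walk last u~x 3≤ = 3≤ , length xs , refl , record
    { vs    = lookup (x ∷ xs)
    ; inj   = lookup-injective x∷xs! _ _
    ; steps = steps x xs walk
    ; close = subst (λ w → Adj Γ w x) (sym (lookup-fromℕ x xs last)) u~x
    }
    where
      steps : ∀ x xs → Linked (Adj Γ) (x ∷ xs) → ∀ i → Adj Γ (lookup (x ∷ xs) (inject₁ i)) (lookup (x ∷ xs) (suc i))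
      steps x (y ∷ xs) (x~y ∷ _)    zero    = x~y
      steps x (y ∷ xs) (_   ∷ walk) (suc i) = steps y xs walk i

  ClosedWalk : Fin n → List (Fin n) → Set
  ClosedWalk x rest = Last rest x × Linked (Adj Γ) (x ∷ rest) × NonBacktracking (x ∷ rest)

  closed-walk-length≥3 : ∀ {x rest} → ClosedWalk x rest → 3 ≤ length rest
  closed-walk-length≥3 {rest = _ ∷ []}        ([-] , x~x ∷ _ , _)         = contradiction x~x Adj-irrefl
  closed-walk-length≥3 {rest = _ ∷ _ ∷ []}    (_ ∷ˡ [-] , _ , x≢x ∷ _)   = contradiction refl x≢x
  closed-walk-length≥3 {rest = _ ∷ _ ∷ _ ∷ _} _                          = s≤s (s≤s (s≤s z≤n))

  cycle-of-closed-walk : ∀ {x rest} → ClosedWalk x rest → Unique rest → HasCycleOfLength Γ (length rest)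
  cycle-of-closed-walk {x} {y ∷ rest} closed@(last , x~y ∷ walk , _) rest! =
    cycle-of-walk y rest rest! walk last x~y (closed-walk-length≥3 closed)

  closed-walk-shortcut : ∀ {x} as y bs cs → ClosedWalk x (as ++ y ∷ bs ++ y ∷ cs)
                       → ClosedWalk y (bs ∷ʳ y) × length (bs ∷ʳ y) + 2 ≤ length (as ++ y ∷ bs ++ y ∷ cs)
  closed-walk-shortcut {x} as y bs cs (last , walk , nb) = inner , shorter as cs last walk
    where
      split : x ∷ as ++ y ∷ bs ++ y ∷ cs ≡ (x ∷ as) ++ (y ∷ bs ∷ʳ y) ++ cs
      split = cong (λ w → x ∷ as ++ y ∷ w) (sym (++-assoc bs [ y ] cs))

      inner : ClosedWalk y (bs ∷ʳ y)
      inner = Last-++⁺ bs [-]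
            , Linked-++⁻ˡ (y ∷ bs ∷ʳ y) (Linked-++⁻ʳ (x ∷ as) (subst (Linked (Adj Γ)) split walk))
            , NonBacktracking-++⁻ˡ (y ∷ bs ∷ʳ y) (NonBacktracking-++⁻ʳ (x ∷ as) (subst NonBacktracking split nb))

      arith : ∀ a b c → 1 ≤ a + c → suc b + 2 ≤ a + suc (b + suc c)
      arith a b c 1≤a+c = subst (suc b + 2 ≤_) (sym (rearrange a b c)) (+-monoˡ-≤ (b + 2) 1≤a+c)
        where
          rearrange : ∀ a b c → a + suc (b + suc c) ≡ (a + c) + (b + 2)
          rearrange = solve 3 (λ a b c → a :+ (con 1 :+ (b :+ (con 1 :+ c))) := (a :+ c) :+ (b :+ con 2)) refl

      length-inner : length (bs ∷ʳ y) + 2 ≡ suc (length bs) + 2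
      length-inner = cong (_+ 2) (trans (length-++ bs) (+-comm (length bs) 1))

      length-rest : ∀ as cs → length (as ++ y ∷ bs ++ y ∷ cs) ≡ length as + suc (length bs + suc (length cs))
      length-rest as cs = trans (length-++ as) (cong (λ w → length as + suc w) (length-++ bs))

      shorter : ∀ as cs → Last (as ++ y ∷ bs ++ y ∷ cs) x → Linked (Adj Γ) (x ∷ as ++ y ∷ bs ++ y ∷ cs)
              → length (bs ∷ʳ y) + 2 ≤ length (as ++ y ∷ bs ++ y ∷ cs)
      shorter [] [] last (x~y ∷ _) =
        contradiction (subst (λ w → Adj Γ w y) (Last-functional last (Last-++⁺ (y ∷ bs) [-])) x~y) Adj-irrefl
      shorter (a ∷ as) cs _ _ = subst₂ _≤_ (sym length-inner) (sym (length-rest (a ∷ as) cs))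
                                  (arith (suc (length as)) (length bs) (length cs) (s≤s z≤n))
      shorter [] (c ∷ cs) _ _ = subst₂ _≤_ (sym length-inner) (sym (length-rest [] (c ∷ cs)))
                                  (arith 0 (length bs) (suc (length cs)) (s≤s z≤n))

  closed-walk⇒unique-or-shorter-cycle : ∀ {x rest} → ClosedWalk x rest
                                      → Unique rest ⊎ ∃ λ L → L + 2 ≤ length rest × HasCycleOfLength Γ L
  closed-walk⇒unique-or-shorter-cycle = go (<-wellFounded _)
    where
      go : ∀ {x rest} → Acc _<_ (length rest) → ClosedWalk x rest
         → Unique rest ⊎ ∃ λ L → L + 2 ≤ length rest × HasCycleOfLength Γ L
      go {rest = rest} (acc rec) closed with unique-or-duplicate _≟_ rest
      ... | inj₁ rest! = inj₁ rest!
      ... | inj₂ (as , y , bs , cs , refl) with inner , shorter ← closed-walk-shortcut as y bs cs closed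
                                           with go (rec (≤-trans (m<m+n (length (bs ∷ʳ y)) (s≤s z≤n)) shorter)) inner
      ...   | inj₁ inner! = inj₂ (length (bs ∷ʳ y) , shorter , cycle-of-closed-walk inner inner!)
      ...   | inj₂ (L , L+2≤ , cycle) = inj₂ (L , ≤-trans L+2≤ (≤-trans (m≤m+n _ 2) shorter) , cycle)

  -- ws lists the walk backwards, from its far end to its start v, so that walks are extended
  -- by consing.
  record NBWalk (v : Fin n) (j : ℕ) (ws : List (Fin n)) : Set where
    constructor nbwalk
    field
      length≡ : length ws ≡ suc j
      last    : Last ws v
      linked  : Linked (Adj Γ) ws
      nb      : NonBacktracking ws

  NBWalk-tail : ∀ {v j x ws} → NBWalk v (suc j) (x ∷ ws) → NBWalk v j ws
  NBWalk-tail {ws = []}    (nbwalk () _ _ _)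
  NBWalk-tail {ws = _ ∷ _} (nbwalk ∣ws∣≡ (_ ∷ˡ last) linked nb) =
    nbwalk (suc-injective ∣ws∣≡) last (Linked.tail linked) (NonBacktracking-tail nb)

  NBWalk⇒ClosedWalk : ∀ {v j ws} → NBWalk v (suc j) (v ∷ ws) → ClosedWalk v ws × length ws ≡ suc j
  NBWalk⇒ClosedWalk {ws = []}    (nbwalk () _ _ _)
  NBWalk⇒ClosedWalk {ws = _ ∷ _} (nbwalk ∣ws∣≡ (_ ∷ˡ last) linked nb) = (last , linked , nb) , suc-injective ∣ws∣≡

  NBWalk-nonempty : ∀ {v j} → ¬ NBWalk v j []
  NBWalk-nonempty (nbwalk () _ _ _)

  NBWalk-zero : ∀ {v ws} → NBWalk v 0 ws → ws ≡ [ v ]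
  NBWalk-zero {ws = _ ∷ []} (nbwalk _ [-] _ _) = refl

  glue-walks : ∀ {v a b x y z P Q} → NBWalk v (suc a) (x ∷ y ∷ P) → NBWalk v (suc b) (x ∷ z ∷ Q) → y ≢ z
             → ∃ λ ini → y ∷ P ≡ ini ∷ʳ v × ClosedWalk v (ini ʳ++ x ∷ z ∷ Q)
                       × length (ini ʳ++ x ∷ z ∷ Q) ≡ suc a + suc b
  glue-walks {v} {a} {b} {x} {y} {z} {P} {Q} wP@(nbwalk _ _ walk-P nb-P) wQ@(nbwalk _ _ walk-Q nb-Q) y≢z =
    let ini , y∷P≡ = Last⇒∷ʳ (NBWalk.last tail-P) in ini , y∷P≡ , glued ini y∷P≡ , total ini y∷P≡
    where
      tail-P = NBWalk-tail wP
      tail-Q = NBWalk-tail wQ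
      glued : ∀ ini → y ∷ P ≡ ini ∷ʳ v → ClosedWalk v (ini ʳ++ x ∷ z ∷ Q)
      glued ini y∷P≡ =
          Last-ʳ++⁺ ini (x ∷ˡ NBWalk.last tail-Q)
        , subst (Linked (Adj Γ)) reversed (Linked-ʳ++ Adj-sym (y ∷ P) walk-P walk-Q)
        , subst NonBacktracking reversed (NonBacktracking-ʳ++ (y ∷ P) (z ∷ Q) nb-P nb-Q (just y≢z))
        where
          reversed : (y ∷ P) ʳ++ x ∷ z ∷ Q ≡ v ∷ ini ʳ++ x ∷ z ∷ Q
          reversed = trans (cong (_ʳ++ x ∷ z ∷ Q) y∷P≡) (++-ʳ++ ini)
      total : ∀ ini → y ∷ P ≡ ini ∷ʳ v → length (ini ʳ++ x ∷ z ∷ Q) ≡ suc a + suc b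
      total ini y∷P≡ = trans (length-∷ʳ-ʳ++ ini v x (z ∷ Q))
        (cong₂ _+_ (trans (cong length (sym y∷P≡)) (NBWalk.length≡ tail-P)) (NBWalk.length≡ tail-Q))

module _ {n : ℕ} (Γ : Graph n) {g : ℕ} (no-shorter : ∀ L → L < g → ¬ HasCycleOfLength Γ L)
         (no-g+1 : ¬ HasCycleOfLength Γ (suc g)) where

  closed-walk-is-girth-cycle : ∀ {x rest} → length rest ≤ suc g → ClosedWalk Γ x rest → length rest ≡ g × Unique rest
  closed-walk-is-girth-cycle ≤g+1 closed with closed-walk⇒unique-or-shorter-cycle Γ closed
  ... | inj₂ (L , L+2≤ , cycle) =
    contradiction cycle (no-shorter L (≤-pred (subst (_≤ suc g) (+-comm L 2) (≤-trans L+2≤ ≤g+1))))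
  ... | inj₁ rest! with m≤n⇒m<n∨m≡n ≤g+1
  ...   | inj₂ ≡g+1 = contradiction (subst (HasCycleOfLength Γ) ≡g+1 (cycle-of-closed-walk Γ closed rest!)) no-g+1
  ...   | inj₁ <g+1 with m≤n⇒m<n∨m≡n (≤-pred <g+1)
  ...     | inj₁ <g = contradiction (cycle-of-closed-walk Γ closed rest!) (no-shorter _ <g)
  ...     | inj₂ ≡g = ≡g , rest!

  returning-walk-length : ∀ {v j ws} → NBWalk Γ v (suc j) (v ∷ ws) → suc j ≤ suc g → suc j ≡ g
  returning-walk-length w ≤g+1 with closed , ∣ws∣≡ ← NBWalk⇒ClosedWalk Γ w =
    trans (sym ∣ws∣≡) (proj₁ (closed-walk-is-girth-cycle (subst (_≤ suc g) (sym ∣ws∣≡) ≤g+1) closed))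

  distinct-walks-length : ∀ {v a b P Q} → NBWalk Γ v a P → NBWalk Γ v b Q → head P ≡ head Q → P ≢ Q
                        → a + b ≤ suc g → a + b ≡ g
  distinct-walks-length {a = zero} {zero} wP wQ _ P≢Q _ = contradiction (trans (NBWalk-zero Γ wP) (sym (NBWalk-zero Γ wQ))) P≢Q
  distinct-walks-length {a = zero} {suc b} {Q = x ∷ _} wP wQ ends≡ _ ≤g+1
    with refl ← trans (cong head (sym (NBWalk-zero Γ wP))) ends≡ = returning-walk-length wQ ≤g+1
  distinct-walks-length {a = suc a} {zero} {P = x ∷ _} wP wQ ends≡ _ ≤g+1
    with refl ← trans ends≡ (cong head (NBWalk-zero Γ wQ)) =
    trans (+-identityʳ _) (returning-walk-length wP (subst (_≤ suc g) (+-identityʳ _) ≤g+1))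
  distinct-walks-length {a = suc a} {suc b} {P = x ∷ y ∷ P} {Q = .x ∷ z ∷ Q} wP wQ refl P≢Q ≤g+1 with y ≟ z
  ... | yes refl = contradiction (subst (_≤ suc g) (cong suc (trans (+-suc a b) (cong suc tails))) ≤g+1) 1+n≰n
    where
      tails : a + b ≡ g
      tails = distinct-walks-length (NBWalk-tail Γ wP) (NBWalk-tail Γ wQ) refl (P≢Q ∘ cong (x ∷_))
                (≤-trans (n≤1+n _) (≤-trans (n≤1+n _) (subst (_≤ suc g) (cong suc (+-suc a b)) ≤g+1)))
  ... | no y≢z with _ , _ , closed , ∣R∣≡ ← glue-walks Γ wP wQ y≢z =
    trans (sym ∣R∣≡) (proj₁ (closed-walk-is-girth-cycle (≤-trans (≤-reflexive ∣R∣≡) ≤g+1) closed))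

-- Non-backtracking walks from a vertex

module _ {n : ℕ} (Γ : Graph n) where

  Adj? : (x z : Fin n) → Dec (Adj Γ x z)
  Adj? x z = T? (adj Γ x z)

  neighbours : Fin n → List (Fin n)
  neighbours x = filter (Adj? x) (allFin n)

  neighbours-except : Fin n → Fin n → List (Fin n)
  neighbours-except x y = filter (λ z → Adj? x z ×-dec ¬? (z ≟ y)) (allFin n)

  extensions : List (Fin n) → List (List (Fin n))
  extensions []          = []
  extensions (x ∷ [])    = map (_∷ x ∷ []) (neighbours x)
  extensions (x ∷ y ∷ r) = map (_∷ x ∷ y ∷ r) (neighbours-except x y)

  walks : Fin n → ℕ → List (List (Fin n))
  walks v zero    = [ [ v ] ]
  walks v (suc j) = concatMap extensions (walks v j)

  ∈-walks⁻ : ∀ {v} j {ws} → ws ∈ walks v j → NBWalk Γ v j ws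
  ∈-walks⁻ zero (here refl) = nbwalk refl [-] [-] [-]
  ∈-walks⁻ (suc j) ws∈ with find (∈-concatMap⁻ extensions ws∈)
  ... | w , w∈ , ws∈ext = extend w (∈-walks⁻ j w∈) ws∈ext
    where
      extend : ∀ {v} w {ws} → NBWalk Γ v j w → ws ∈ extensions w → NBWalk Γ v (suc j) ws
      extend (x ∷ []) (nbwalk ∣w∣≡ last linked nb) ws∈
        with z , z∈ , refl ← ∈-map⁻ (_∷ x ∷ []) {xs = neighbours x} ws∈
        with _ , x~z ← ∈-filter⁻ (Adj? x) {xs = allFin n} z∈ =
        nbwalk (cong suc ∣w∣≡) (z ∷ˡ last) (Adj-sym Γ x~z ∷ linked) [-,-]
      extend (x ∷ y ∷ r) (nbwalk ∣w∣≡ last linked nb) ws∈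
        with z , z∈ , refl ← ∈-map⁻ (_∷ x ∷ y ∷ r) {xs = neighbours-except x y} ws∈
        with _ , x~z , z≢y ← ∈-filter⁻ (λ z → Adj? x z ×-dec ¬? (z ≟ y)) {xs = allFin n} z∈ =
        nbwalk (cong suc ∣w∣≡) (z ∷ˡ last) (Adj-sym Γ x~z ∷ linked) (z≢y ∷ nb)

  ∈-walks⁺ : ∀ {v} j {ws} → NBWalk Γ v j ws → ws ∈ walks v j
  ∈-walks⁺ zero w with refl ← NBWalk-zero Γ w = here refl
  ∈-walks⁺ (suc j) {z ∷ x ∷ r} w@(nbwalk _ _ (z~x ∷ _) nb) =
    ∈-concatMap⁺ extensions (lose (∈-walks⁺ j (NBWalk-tail Γ w)) (extends r nb))
    where
      extends : ∀ r → NonBacktracking (z ∷ x ∷ r) → z ∷ x ∷ r ∈ extensions (x ∷ r)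
      extends []      _         = ∈-map⁺ (_∷ x ∷ []) (∈-filter⁺ (Adj? x) (∈-allFin z) (Adj-sym Γ z~x))
      extends (y ∷ r) (z≢y ∷ _) =
        ∈-map⁺ (_∷ x ∷ y ∷ r) (∈-filter⁺ (λ z → Adj? x z ×-dec ¬? (z ≟ y)) (∈-allFin z) (Adj-sym Γ z~x , z≢y))
  ∈-walks⁺ (suc j) {_ ∷ []} (nbwalk () _ _ _)

  ∈-extensions⁻ : ∀ w {ws} → ws ∈ extensions w → ∃ λ z → ws ≡ z ∷ w
  ∈-extensions⁻ (x ∷ [])    ws∈ with z , _ , eq ← ∈-map⁻ (_∷ x ∷ []) {xs = neighbours x} ws∈ = z , eq
  ∈-extensions⁻ (x ∷ y ∷ r) ws∈ with z , _ , eq ← ∈-map⁻ (_∷ x ∷ y ∷ r) {xs = neighbours-except x y} ws∈ = z , eq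

  extensions! : ∀ w → Unique (extensions w)
  extensions! []          = []
  extensions! (x ∷ [])    = Unique.map⁺ ∷-injectiveˡ (Unique.filter⁺ (Adj? x) (Unique.allFin⁺ n))
  extensions! (x ∷ y ∷ r) =
    Unique.map⁺ ∷-injectiveˡ (Unique.filter⁺ (λ z → Adj? x z ×-dec ¬? (z ≟ y)) (Unique.allFin⁺ n))

  walks! : ∀ v j → Unique (walks v j)
  walks! v zero    = [] ∷ []
  walks! v (suc j) = Unique-concatMap⁺ extensions (walks! v j) (λ {w} _ → extensions! w) disjoint
    where
      disjoint : ∀ {w w′} → w ∈ walks v j → w′ ∈ walks v j → w ≢ w′ → Disjoint (extensions w) (extensions w′)
      disjoint {w} {w′} _ _ w≢w′ (ws∈ , ws∈′) with z , refl ← ∈-extensions⁻ w ws∈ | z′ , eq ← ∈-extensions⁻ w′ ws∈′ =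
        w≢w′ (∷-injectiveʳ eq)

  module _ {k : ℕ} (regular : Regular k Γ) where

    length-neighbours : ∀ x → length (neighbours x) ≡ k
    length-neighbours x = trans (length-filter≡sum (Adj? x) (allFin n)) (regular x)

    length-extensions : ∀ {v} j {w} → w ∈ walks v (suc j) → length (extensions w) ≡ k ∸ 1
    length-extensions j {x ∷ y ∷ r} w∈ with ∈-walks⁻ (suc j) w∈
    ... | nbwalk _ _ (x~y ∷ _) _ = begin
      length (map (_∷ x ∷ y ∷ r) (neighbours-except x y))  ≡⟨ length-map _ (neighbours-except x y) ⟩
      length (neighbours-except x y)                       ≡⟨ cong (_∸ 1) all-but-y ⟩
      k ∸ 1                                                ∎
      where
        open ≡-Reasoning
        all-but-y : suc (length (neighbours-except x y)) ≡ k
        all-but-y = trans (length-filter-≢ _≟_ (Adj? x) (allFin n) (Unique.allFin⁺ n) (∈-allFin y) x~y) (length-neighbours x)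
    length-extensions j {_ ∷ []} w∈ with nbwalk () _ _ _ ← ∈-walks⁻ (suc j) w∈
    length-extensions j {[]} w∈ with nbwalk () _ _ _ ← ∈-walks⁻ (suc j) w∈

    length-walks : ∀ v j → length (walks v j) ≡ walk-count k j
    length-walks v zero          = refl
    length-walks v (suc zero)    = begin
      length (extensions [ v ] ++ [])  ≡⟨ trans (length-++ (extensions [ v ])) (+-identityʳ _) ⟩
      length (extensions [ v ])        ≡⟨ length-map _ (neighbours v) ⟩
      length (neighbours v)            ≡⟨ length-neighbours v ⟩
      k                                ≡⟨ *-identityʳ k ⟨
      k * 1                            ∎
      where open ≡-Reasoning
    length-walks v (suc (suc j)) = begin
      length (concatMap extensions (walks v (suc j)))              ≡⟨ length-concatMap extensions (walks v (suc j)) ⟩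
      sum (map (length ∘ extensions) (walks v (suc j)))            ≡⟨ sum-map-const _ (walks v (suc j)) (length-extensions j) ⟩
      length (walks v (suc j)) * (k ∸ 1)                           ≡⟨ cong (_* (k ∸ 1)) (length-walks v (suc j)) ⟩
      k * (k ∸ 1) ^ j * (k ∸ 1)                                    ≡⟨ *-assoc k _ _ ⟩
      k * ((k ∸ 1) ^ j * (k ∸ 1))                                  ≡⟨ cong (k *_) (*-comm ((k ∸ 1) ^ j) (k ∸ 1)) ⟩
      k * (k ∸ 1) ^ suc j                                          ∎
      where open ≡-Reasoning

module MooreBall {n : ℕ} (Γ : Graph n) {t : ℕ}
                 (no-shorter : ∀ L → L < 2 * t + 1 → ¬ HasCycleOfLength Γ L)
                 (no-2t+2 : ¬ HasCycleOfLength Γ (suc (2 * t + 1)))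
                 (v : Fin n) where

  walks-with-common-endpoint : ∀ {a b P Q} → NBWalk Γ v a P → NBWalk Γ v b Q → head P ≡ head Q
                             → a + b ≤ suc (2 * t + 1) → a + b ≢ 2 * t + 1 → P ≡ Q
  walks-with-common-endpoint {P = P} {Q} wP wQ ends≡ a+b≤ a+b≢ with List.≡-dec _≟_ P Q
  ... | yes P≡Q = P≡Q
  ... | no P≢Q  = contradiction (distinct-walks-length Γ no-shorter no-2t+2 wP wQ ends≡ P≢Q a+b≤) a+b≢

  short-walks-with-common-endpoint : ∀ {a b P Q} → NBWalk Γ v a P → NBWalk Γ v b Q → head P ≡ head Q
                                   → a + b ≤ t + t → P ≡ Q
  short-walks-with-common-endpoint wP wQ ends≡ a+b≤ =
    walks-with-common-endpoint wP wQ ends≡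
      (≤-trans a+b≤ (≤-trans (n≤1+n _) (≤-trans (n≤1+n _) (≤-reflexive (cong suc (sym (2t+1≡suc[t+t] t)))))))
      (λ a+b≡ → 1+n≰n (≤-trans (≤-reflexive (trans (sym (2t+1≡suc[t+t] t)) (sym a+b≡))) a+b≤))

  longest-walks-with-common-endpoint : ∀ {P Q} → NBWalk Γ v (suc t) P → NBWalk Γ v (suc t) Q → head P ≡ head Q → P ≡ Q
  longest-walks-with-common-endpoint wP wQ ends≡ =
    walks-with-common-endpoint wP wQ ends≡ (≤-reflexive 2t+2≡) (λ eq → 1+n≰n (≤-reflexive (trans (sym 2t+2≡) eq)))
    where
      2t+2≡ : suc t + suc t ≡ suc (2 * t + 1)
      2t+2≡ = cong suc (trans (+-suc t t) (sym (2t+1≡suc[t+t] t)))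

  ends-differ : ∀ {a b P Q} → a ≢ b → NBWalk Γ v a P → NBWalk Γ v b Q → a + b ≤ t + t → head P ≢ head Q
  ends-differ a≢b wP wQ a+b≤ ends≡ with refl ← short-walks-with-common-endpoint wP wQ ends≡ a+b≤ =
    a≢b (suc-injective (trans (sym (NBWalk.length≡ wP)) (NBWalk.length≡ wQ)))

  walks-ends-distinct : ∀ j → j ≤ t → AllPairs (λ P Q → head P ≢ head Q) (walks Γ v j)
  walks-ends-distinct j j≤t = Unique⇒AllPairs (walks! Γ v j) λ P∈ Q∈ P≢Q ends≡ →
    P≢Q (short-walks-with-common-endpoint (∈-walks⁻ Γ j P∈) (∈-walks⁻ Γ j Q∈) ends≡ (+-mono-≤ j≤t j≤t))

  ball : ℕ → List (List (Fin n))
  ball zero    = walks Γ v 0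
  ball (suc j) = ball j ++ walks Γ v (suc j)

  ∈-ball⁻ : ∀ j {P} → P ∈ ball j → ∃ λ a → a ≤ j × P ∈ walks Γ v a
  ∈-ball⁻ zero    P∈ = 0 , z≤n , P∈
  ∈-ball⁻ (suc j) P∈ with ∈-++⁻ (ball j) P∈
  ... | inj₁ P∈ball = let a , a≤j , P∈walks = ∈-ball⁻ j P∈ball in a , m≤n⇒m≤1+n a≤j , P∈walks
  ... | inj₂ P∈walks = suc j , ≤-refl , P∈walks

  ball-ends-distinct : ∀ j → j ≤ t → AllPairs (λ P Q → head P ≢ head Q) (ball j)
  ball-ends-distinct zero    _   = walks-ends-distinct 0 z≤n
  ball-ends-distinct (suc j) j<t =
    AllPairs.++⁺ (ball-ends-distinct j (≤-trans (n≤1+n j) j<t)) (walks-ends-distinct (suc j) j<t)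
      (All.tabulate λ P∈ → All.tabulate λ Q∈ →
        let a , a≤j , P∈walks = ∈-ball⁻ j P∈ in
        ends-differ (λ a≡ → 1+n≰n (subst (_≤ j) a≡ a≤j)) (∈-walks⁻ Γ a P∈walks) (∈-walks⁻ Γ (suc j) Q∈)
          (+-mono-≤ (≤-trans a≤j (≤-trans (n≤1+n j) j<t)) j<t))

  EndsOnSphere : List (Fin n) → Set
  EndsOnSphere P = Any (λ Q → head Q ≡ head P) (walks Γ v t)

  endsOnSphere? : (P : List (Fin n)) → Dec (EndsOnSphere P)
  endsOnSphere? P = any? (λ Q → Maybe.≡-dec _≟_ (head Q) (head P)) (walks Γ v t)

  landing : List (List (Fin n))
  landing = filter endsOnSphere? (walks Γ v (suc t))

  escaping : List (List (Fin n))
  escaping = filter (∁? endsOnSphere?) (walks Γ v (suc t))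

  private
    ∈-walks⁻-filter : ∀ {P} {p} {Pr : List (Fin n) → Set p} (Pr? : (P : List (Fin n)) → Dec (Pr P))
                    → P ∈ filter Pr? (walks Γ v (suc t)) → NBWalk Γ v (suc t) P
    ∈-walks⁻-filter Pr? P∈ = ∈-walks⁻ Γ (suc t) (proj₁ (∈-filter⁻ Pr? P∈))

    filtered-ends-distinct : ∀ {p} {Pr : List (Fin n) → Set p} (Pr? : (P : List (Fin n)) → Dec (Pr P))
                           → AllPairs (λ P Q → head P ≢ head Q) (filter Pr? (walks Γ v (suc t)))
    filtered-ends-distinct Pr? = Unique⇒AllPairs (Unique.filter⁺ Pr? (walks! Γ v (suc t))) λ P∈ Q∈ P≢Q ends≡ →
      P≢Q (longest-walks-with-common-endpoint (∈-walks⁻-filter Pr? P∈) (∈-walks⁻-filter Pr? Q∈) ends≡)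

  ball++escaping-ends-distinct : AllPairs (λ P Q → head P ≢ head Q) (ball t ++ escaping)
  ball++escaping-ends-distinct = AllPairs.++⁺ (ball-ends-distinct t ≤-refl) (filtered-ends-distinct (∁? endsOnSphere?))
    (All.tabulate λ P∈ → All.tabulate λ Q∈ →
      let a , a≤t , P∈walks = ∈-ball⁻ t P∈ ; Q∈walks , Q-escapes = ∈-filter⁻ (∁? endsOnSphere?) Q∈ in
      by-radius a≤t P∈walks (∈-walks⁻ Γ (suc t) Q∈walks) Q-escapes)
    where
      by-radius : ∀ {a P Q} → a ≤ t → P ∈ walks Γ v a → NBWalk Γ v (suc t) Q → ¬ EndsOnSphere Q → head P ≢ head Q
      by-radius {a} a≤t P∈walks wQ Q-escapes ends≡ with m≤n⇒m<n∨m≡n a≤t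
      ... | inj₂ refl = Q-escapes (lose P∈walks ends≡)
      ... | inj₁ a<t  = ends-differ (λ a≡ → 1+n≰n (≤-trans (n≤1+n (suc t)) (subst (λ x → suc x ≤ t) a≡ a<t)))
                          (∈-walks⁻ Γ a P∈walks) wQ (≤-trans (≤-reflexive (+-suc a t)) (+-mono-≤ a<t ≤-refl)) ends≡

  length-ball+escaping≤n : length (ball t) + length escaping ≤ n
  length-ball+escaping≤n = subst (_≤ n) (length-++ (ball t))
    (distinct-heads⇒length≤ ball++escaping-ends-distinct nonempty)
    where
      nonempty : ∀ {P} → P ∈ ball t ++ escaping → P ≢ []
      nonempty P∈ refl with ∈-++⁻ (ball t) P∈
      ... | inj₁ P∈ball = let a , _ , P∈walks = ∈-ball⁻ t P∈ball in NBWalk-nonempty Γ (∈-walks⁻ Γ a P∈walks)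
      ... | inj₂ P∈esc  = NBWalk-nonempty Γ (∈-walks⁻ Γ (suc t) (proj₁ (∈-filter⁻ (∁? endsOnSphere?) P∈esc)))

  length-landing≤ : length landing ≤ length (walks Γ v t)
  length-landing≤ = begin
    length landing                    ≡⟨ length-map head landing ⟨
    length (map head landing)         ≤⟨ length-≤-of-⊆ (AllPairs.map⁺ (filtered-ends-distinct endsOnSphere?)) heads⊆ ⟩
    length (map head (walks Γ v t))   ≡⟨ length-map head (walks Γ v t) ⟩
    length (walks Γ v t)              ∎
    where
      open ≤-Reasoning
      heads⊆ : map head landing ⊆ map head (walks Γ v t)
      heads⊆ h∈ with P , P∈ , refl ← ∈-map⁻ head {xs = landing} h∈
        with Q , Q∈ , Q-end≡ ← find (proj₂ (∈-filter⁻ endsOnSphere? {xs = walks Γ v (suc t)} P∈)) =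
        subst (_∈ map head (walks Γ v t)) Q-end≡ (∈-map⁺ head Q∈)

  length-landing+escaping : length landing + length escaping ≡ length (walks Γ v (suc t))
  length-landing+escaping = length-filter+length-filter-∁ endsOnSphere? (walks Γ v (suc t))

  module _ {k : ℕ} (regular : Regular k Γ) where

    length-ball : ∀ j → length (ball j) ≡ ball-count k j
    length-ball zero    = length-walks Γ regular v 0
    length-ball (suc j) = trans (length-++ (ball j)) (cong₂ _+_ (length-ball j) (length-walks Γ regular v (suc j)))

    length-landing : 2 ≤ k → 1 ≤ t → n ≡ ball-count k t + (k ∸ 2) * walk-count k t → length landing ≡ walk-count k t
    length-landing 2≤k 1≤t n≡ = ≤-antisym upper lower
      where
        open ≤-Reasoning
        L = walk-count k t
        upper : length landing ≤ L
        upper = subst (length landing ≤_) (length-walks Γ regular v t) length-landing≤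
        escaping≤ : length escaping ≤ (k ∸ 2) * L
        escaping≤ = +-cancelˡ-≤ (ball-count k t) _ _
          (subst₂ _≤_ (cong (_+ length escaping) (length-ball t)) n≡ length-ball+escaping≤n)
        lower : L ≤ length landing
        lower = +-cancelʳ-≤ ((k ∸ 2) * L) L (length landing) (begin
          L + (k ∸ 2) * L                    ≡⟨ walk-count-suc 2≤k 1≤t ⟨
          walk-count k (suc t)               ≡⟨ trans length-landing+escaping (length-walks Γ regular v (suc t)) ⟨
          length landing + length escaping   ≤⟨ +-monoʳ-≤ (length landing) escaping≤ ⟩
          length landing + (k ∸ 2) * L       ∎)

-- Rooted oriented cycles

module _ {n : ℕ} (Γ : Graph n) where

  -- A cycle listed from any of its vertices in either direction, so that a cycle of
  -- length L is listed 2L times.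
  IsCycle : List (Fin n) → Set
  IsCycle []       = ⊥
  IsCycle (x ∷ xs) = Unique (x ∷ xs) × Linked (Adj Γ) (last⁺ x xs ∷ x ∷ xs)

  isCycle? : Decidable IsCycle
  isCycle? []       = no λ ()
  isCycle? (x ∷ xs) = UniqueDec.unique? _≟_ (x ∷ xs) ×-dec linked? (Adj? Γ) (last⁺ x xs ∷ x ∷ xs)

  IsCycle⇒Unique : ∀ {c} → IsCycle c → Unique c
  IsCycle⇒Unique {_ ∷ _} = proj₁

  IsCycle-rotate : ∀ {c} → IsCycle c → IsCycle (rotate c)
  IsCycle-rotate {x ∷ []}    cycle = cycle
  IsCycle-rotate {x ∷ y ∷ r} (x∉ ∷ y∷r! , last~x ∷ x~y ∷ walk) =
      Unique.++⁺ y∷r! ([] ∷ []) (λ { (z∈ , here refl) → All.lookup x∉ z∈ refl })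
    , subst (λ u → Linked (Adj Γ) (u ∷ y ∷ r ∷ʳ x)) (sym (last⁺-∷ʳ y r x)) (x~y ∷ Linked-∷ʳ y r walk last~x)

  IsCycle-closed : ∀ {c v} → IsCycle c → Last c v → Linked (Adj Γ) (v ∷ c)
  IsCycle-closed {x ∷ xs} (_ , linked) last =
    subst (λ u → Linked (Adj Γ) (u ∷ x ∷ xs)) (Last-functional (Last-last⁺ x xs) last) linked

  ClosedWalk⇒IsCycle : ∀ {v c} → ClosedWalk Γ v c → Unique c → IsCycle c
  ClosedWalk⇒IsCycle {c = x ∷ xs} (last , linked , _) c! =
    c! , subst (λ u → Linked (Adj Γ) (u ∷ x ∷ xs)) (sym (Last-functional (Last-last⁺ x xs) last)) linked

  cycles : ℕ → List (List (Fin n))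
  cycles L = filter isCycle? (lists-of-length (allFin n) L)

  ∈-cycles⁻ : ∀ {L c} → c ∈ cycles L → IsCycle c × length c ≡ L
  ∈-cycles⁻ {L} c∈ = let c∈lists , cycle = ∈-filter⁻ isCycle? {xs = lists-of-length (allFin n) L} c∈ in
    cycle , ∈-lists-of-length⁻ L c∈lists

  ∈-cycles⁺ : ∀ {L c} → IsCycle c → length c ≡ L → c ∈ cycles L
  ∈-cycles⁺ {L} cycle ∣c∣≡ = ∈-filter⁺ isCycle? (∈-lists-of-length⁺ L (All.tabulate (λ {x} _ → ∈-allFin x)) ∣c∣≡) cycle

  cycles! : ∀ L → Unique (cycles L)
  cycles! L = Unique.filter⁺ isCycle? (lists-of-length! L (Unique.allFin⁺ n))

  ∣length-cycles : ∀ L → L ∣ length (cycles L)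
  ∣length-cycles zero    = divides 0 refl
  ∣length-cycles (suc m) = rotation-closed⇒∣length m (cycles! (suc m))
    (IsCycle⇒Unique ∘ proj₁ ∘ ∈-cycles⁻ {suc m}) (proj₂ ∘ ∈-cycles⁻ {suc m})
    (λ {c} c∈ → let cycle , ∣c∣≡ = ∈-cycles⁻ {suc m} c∈ in
                ∈-cycles⁺ (IsCycle-rotate cycle) (trans (length-rotate c) ∣c∣≡))

  cycles-through : Fin n → ℕ → List (List (Fin n))
  cycles-through v L = filter (λ c → Last? _≟_ c v) (cycles L)

  length-cycles≡sum : ∀ L → length (cycles L) ≡ sum (map (λ v → length (cycles-through v L)) (allFin n))
  length-cycles≡sum L = length-≡-sum-of-fibres (Last? _≟_) (allFin n) (cycles L) one-last
    where
      one-last : ∀ {c} → c ∈ cycles L → length (filter (Last? _≟_ c) (allFin n)) ≡ 1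
      one-last {x ∷ xs} _ = length-filter-unique-witness (Last? _≟_ (x ∷ xs)) (allFin n) (Unique.allFin⁺ n)
                              (∈-allFin (last⁺ x xs)) (Last-last⁺ x xs) (sym ∘ Last-functional (Last-last⁺ x xs))
      one-last {[]} c∈ with () ← proj₁ (∈-cycles⁻ {L} c∈)

module CyclesThrough {n : ℕ} (Γ : Graph n) {t′ : ℕ}
                     (no-shorter : ∀ L → L < 2 * suc t′ + 1 → ¬ HasCycleOfLength Γ L)
                     (no-2t+2 : ¬ HasCycleOfLength Γ (suc (2 * suc t′ + 1)))
                     (v : Fin n) where

  private
    t : ℕ
    t = suc t′

  open MooreBall Γ {t} no-shorter no-2t+2 v

  -- For a cycle c through v, of length 2t + 1 and ending at v, the first t + 1 vertices read
  -- back to v form a walk of length t + 1; the remaining t vertices and v form a walk of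
  -- length t with the same endpoint.
  cut : List (Fin n) → List (Fin n)
  cut c = take (suc t) c ʳ++ [ v ]

  cut-split : ∀ as x bs → length as ≡ t → cut (as ++ x ∷ bs) ≡ x ∷ as ʳ++ [ v ]
  cut-split as x bs ∣as∣≡ = trans (cong (_ʳ++ [ v ]) (take-suc-++ as x bs ∣as∣≡)) (++-ʳ++ as)

  private
    length-second-half : ∀ (as : List (Fin n)) x bs → length as ≡ t → length (as ++ x ∷ bs) ≡ 2 * t + 1 → length bs ≡ t
    length-second-half as x bs ∣as∣≡ ∣c∣≡ = +-cancelˡ-≡ t _ _ (suc-injective (begin
      suc (t + length bs)           ≡⟨ +-suc t (length bs) ⟨
      t + length (x ∷ bs)           ≡⟨ cong (_+ length (x ∷ bs)) ∣as∣≡ ⟨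
      length as + length (x ∷ bs)   ≡⟨ length-++ as ⟨
      length (as ++ x ∷ bs)         ≡⟨ trans ∣c∣≡ (2t+1≡suc[t+t] t) ⟩
      suc (t + t)                   ∎))
      where open ≡-Reasoning

    first-half-avoids-end : ∀ (as : List (Fin n)) x bs → Unique (as ++ x ∷ bs) → Last (x ∷ bs) v → length bs ≡ t
                          → Unique (v ∷ as ∷ʳ x)
    first-half-avoids-end as x []          _  _          ()
    first-half-avoids-end as x bs@(_ ∷ _) c! (_ ∷ˡ last) _
      with as∷ʳx! , _ , disjoint ← Unique-++⁻ (as ∷ʳ x) (subst Unique (sym (++-assoc as [ x ] bs)) c!) =
      All.tabulate (λ z∈ v≡z → disjoint (subst (_∈ as ∷ʳ x) (sym v≡z) z∈ , Last⇒∈ last)) ∷ as∷ʳx!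

  halves-of : ∀ (as : List (Fin n)) x bs → IsCycle Γ (as ++ x ∷ bs) → Last (as ++ x ∷ bs) v
            → length (as ++ x ∷ bs) ≡ 2 * t + 1 → length as ≡ t
            → NBWalk Γ v t (x ∷ bs) × NBWalk Γ v (suc t) (x ∷ as ʳ++ [ v ])
  halves-of as x bs cycle last ∣c∣≡ ∣as∣≡ = outer , subst (NBWalk Γ v (suc t)) (++-ʳ++ as) inner
    where
      c! = IsCycle⇒Unique Γ cycle
      closed : Linked (Adj Γ) (v ∷ as ++ x ∷ bs)
      closed = IsCycle-closed Γ cycle last
      ∣bs∣≡ = length-second-half as x bs ∣as∣≡ ∣c∣≡
      last-outer : Last (x ∷ bs) v
      last-outer = Last-++⁻ as last
      outer : NBWalk Γ v t (x ∷ bs)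
      outer = nbwalk (cong suc ∣bs∣≡) last-outer (Linked-++⁻ʳ as (Linked.tail closed))
                (Unique⇒NonBacktracking (proj₁ (proj₂ (Unique-++⁻ as c!))))
      inner : NBWalk Γ v (suc t) ((as ∷ʳ x) ʳ++ [ v ])
      inner = nbwalk ∣inner∣≡ (Last-ʳ++⁺ (as ∷ʳ x) [-])
        (Linked-ʳ++ (Adj-sym Γ) (as ∷ʳ x) closed-first-half [-])
        (NonBacktracking-ʳ++ (as ∷ʳ x) [] (Unique⇒NonBacktracking (first-half-avoids-end as x bs c! last-outer ∣bs∣≡)) [-]
          (Connected-nothing (head (as ∷ʳ x))))
        where
          ∣inner∣≡ : length ((as ∷ʳ x) ʳ++ [ v ]) ≡ suc (suc t)
          ∣inner∣≡ = trans (length-ʳ++ (as ∷ʳ x))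
                       (trans (+-comm _ 1) (cong suc (trans (length-++ as) (trans (+-comm (length as) 1) (cong suc ∣as∣≡)))))
          closed-first-half : Linked (Adj Γ) (v ∷ as ∷ʳ x)
          closed-first-half = Linked-++⁻ˡ (v ∷ as ∷ʳ x) (subst (Linked (Adj Γ) ∘ (v ∷_)) (sym (++-assoc as [ x ] bs)) closed)

  halves : ∀ {c} → c ∈ cycles-through Γ v (2 * t + 1)
         → ∃₂ λ as x → ∃ λ bs → c ≡ as ++ x ∷ bs × length as ≡ t
                              × NBWalk Γ v t (x ∷ bs) × NBWalk Γ v (suc t) (x ∷ as ʳ++ [ v ])
  halves {c} c∈ with c∈cycles , last ← ∈-filter⁻ (λ c → Last? _≟_ c v) {xs = cycles Γ (2 * t + 1)} c∈
                with cycle , ∣c∣≡ ← ∈-cycles⁻ Γ {2 * t + 1} c∈cycles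
                with as , x , bs , refl , ∣as∣≡ ← split-at t c (subst (t <_) (sym (trans ∣c∣≡ (2t+1≡suc[t+t] t)))
                                                                     (s≤s (m≤m+n t t))) =
    as , x , bs , refl , ∣as∣≡ , halves-of as x bs cycle last ∣c∣≡ ∣as∣≡

  cut-into : ∀ {c} → c ∈ cycles-through Γ v (2 * t + 1) → cut c ∈ landing
  cut-into c∈ with as , x , bs , refl , ∣as∣≡ , outer , inner ← halves c∈ =
    subst (_∈ landing) (sym (cut-split as x bs ∣as∣≡))
      (∈-filter⁺ endsOnSphere? (∈-walks⁺ Γ (suc t) inner) (lose (∈-walks⁺ Γ t outer) refl))

  cut-injective : ∀ {c c′} → c ∈ cycles-through Γ v (2 * t + 1) → c′ ∈ cycles-through Γ v (2 * t + 1)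
                → cut c ≡ cut c′ → c ≡ c′
  cut-injective c∈ c′∈ cuts≡
    with as , x , bs , refl , ∣as∣≡ , outer , _ ← halves c∈
    with as′ , x′ , bs′ , refl , ∣as′∣≡ , outer′ , _ ← halves c′∈
    with trans (sym (cut-split as x bs ∣as∣≡)) (trans cuts≡ (cut-split as′ x′ bs′ ∣as′∣≡))
  ... | x∷≡x′∷ with refl ← ∷-injectiveˡ x∷≡x′∷ with refl ← ʳ++-injectiveˡ as as′ (∷-injectiveʳ x∷≡x′∷) =
    cong (as ++_) (short-walks-with-common-endpoint outer outer′ refl ≤-refl)

  glue-to-cycle : ∀ x y P z Q → NBWalk Γ v (suc t) (x ∷ y ∷ P) → NBWalk Γ v t (x ∷ z ∷ Q)
                → ∃ λ c → c ∈ cycles-through Γ v (2 * t + 1) × cut c ≡ x ∷ y ∷ P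
  glue-to-cycle x y P z Q wP wQ with y ≟ z
  ... | yes refl = contradiction refl (ends-differ 1+n≢n (NBWalk-tail Γ wP) (NBWalk-tail Γ wQ) (+-mono-≤ ≤-refl (n≤1+n t′)))
  ... | no y≢z with ini , y∷P≡ , closed , ∣R∣≡ ← glue-walks Γ wP wQ y≢z =
    R , ∈-filter⁺ (λ c → Last? _≟_ c v) (∈-cycles⁺ Γ (ClosedWalk⇒IsCycle Γ closed R!) ∣R∣≡′) (proj₁ closed) , cut-R
    where
      R = ini ʳ++ x ∷ z ∷ Q
      ∣R∣≡′ : length R ≡ 2 * t + 1
      ∣R∣≡′ = trans ∣R∣≡ (sym (2t+1≡suc[t+t] t))
      R! : Unique R
      R! = proj₂ (closed-walk-is-girth-cycle Γ no-shorter no-2t+2 (≤-trans (≤-reflexive ∣R∣≡′) (n≤1+n _)) closed)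
      ∣ini∣≡ : length (reverse ini) ≡ t
      ∣ini∣≡ = trans (length-reverse ini) (suc-injective (trans (trans (+-comm 1 (length ini)) (sym (length-++ ini)))
                 (trans (cong length (sym y∷P≡)) (NBWalk.length≡ (NBWalk-tail Γ wP)))))
      cut-R : cut R ≡ x ∷ y ∷ P
      cut-R = begin
        cut R                                ≡⟨ cong cut (ʳ++-defn ini) ⟩
        cut (reverse ini ++ x ∷ z ∷ Q)       ≡⟨ cut-split (reverse ini) x (z ∷ Q) ∣ini∣≡ ⟩
        x ∷ reverse ini ʳ++ [ v ]            ≡⟨ cong (x ∷_) (ʳ++-ʳ++ ini) ⟩
        x ∷ ini ∷ʳ v                         ≡⟨ cong (x ∷_) y∷P≡ ⟨
        x ∷ y ∷ P                            ∎
        where open ≡-Reasoning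

  cut-onto : ∀ {P} → P ∈ landing → ∃ λ c → c ∈ cycles-through Γ v (2 * t + 1) × cut c ≡ P
  cut-onto {P} P∈ with P∈walks , on-sphere ← ∈-filter⁻ endsOnSphere? {xs = walks Γ v (suc t)} P∈
                  with Q , Q∈walks , ends≡ ← find on-sphere =
    glue (∈-walks⁻ Γ (suc t) P∈walks) (∈-walks⁻ Γ t Q∈walks) ends≡
    where
      glue : ∀ {P Q} → NBWalk Γ v (suc t) P → NBWalk Γ v t Q → head Q ≡ head P
           → ∃ λ c → c ∈ cycles-through Γ v (2 * t + 1) × cut c ≡ P
      glue {x ∷ y ∷ P} {.x ∷ z ∷ Q} wP wQ refl = glue-to-cycle x y P z Q wP wQ
      glue {[]}            (nbwalk () _ _ _) _ _
      glue {_ ∷ []}        (nbwalk () _ _ _) _ _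
      glue {_ ∷ _ ∷ _} {[]}     _ (nbwalk () _ _ _) _
      glue {_ ∷ _ ∷ _} {_ ∷ []} _ (nbwalk () _ _ _) _

  length-cycles-through : length (cycles-through Γ v (2 * t + 1)) ≡ length landing
  length-cycles-through = length-≡-of-bijection cut
    (Unique.filter⁺ (λ c → Last? _≟_ c v) (cycles! Γ (2 * t + 1))) (Unique.filter⁺ endsOnSphere? (walks! Γ v (suc t)))
    cut-injective cut-into cut-onto

proposition2 : (k t : ℕ) → (k≥3 : 3 ≤ k) → 1 ≤ t → {n : ℕ} → (Γ : Graph n) → Regular k Γ → Girth Γ (2 * t + 1) → ¬ HasCycleOfLength Γ (2 * t + 2) → n ≡ moore k t k≥3 + (k ∸ 2) * k * (k ∸ 1) ^ (t ∸ 1) → (4 * t + 2) ∣ ((moore k t k≥3 + (k ∸ 2) * k * (k ∸ 1) ^ (t ∸ 1)) * (k * (k ∸ 1) ^ (t ∸ 1)))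
proposition2 k t@(suc t′) k≥3 (s≤s z≤n) {n} Γ regular (_ , no-shorter) no-2t+2 n≡ =
  subst (λ m → 4 * t + 2 ∣ m * L) n≡ (subst (_∣ n * L) (4t+2≡ t) (coprime-∣⇒*∣ (2t+1-coprime-2 t) g∣nL 2∣nL))
  where
    g = 2 * t + 1
    L = walk-count k t
    no-g+1 : ¬ HasCycleOfLength Γ (suc g)
    no-g+1 = subst (¬_ ∘ HasCycleOfLength Γ) (+-suc (2 * t) 1) no-2t+2
    n≡ball : n ≡ ball-count k t + (k ∸ 2) * L
    n≡ball = trans n≡ (cong₂ _+_ (moore≡ball-count k t k≥3) (*-assoc (k ∸ 2) k _))
    cycles-through-v : ∀ v → length (cycles-through Γ v g) ≡ L
    cycles-through-v v = trans (CyclesThrough.length-cycles-through Γ no-shorter no-g+1 v)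
      (MooreBall.length-landing Γ no-shorter no-g+1 v regular (≤-trans (n≤1+n 2) k≥3) (s≤s z≤n) n≡ball)
    cycle-count : length (cycles Γ g) ≡ n * L
    cycle-count = trans (length-cycles≡sum Γ g)
      (trans (sum-map-const _ (allFin n) (λ {v} _ → cycles-through-v v)) (cong (_* L) (length-tabulate {n = n} (λ i → i))))
    g∣nL : g ∣ n * L
    g∣nL = subst (g ∣_) cycle-count (∣length-cycles Γ g)
    2∣nL : 2 ∣ n * L
    2∣nL = subst (2 ∣_) (*-assoc n k _) (∣m⇒∣m*n _ (regular⇒2∣n*k Γ regular))
    4t+2≡ : ∀ t → (2 * t + 1) * 2 ≡ 4 * t + 2
    4t+2≡ = solve 1 (λ t → (con 2 :* t :+ con 1) :* con 2 := con 4 :* t :+ con 2) refl
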